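{- Let $p\equiv\pm1\pmod{10}$ be a prime and $n\geq1$ an integer such that $\mathcal{S}_{p,n}:=p^2 16^n+1$ is prime. Let $E$ be the elliptic curve $y^2=x^3-x$ and $E_{30}$ the elliptic curve $30y^2=x^3-x$, both over $\mathbb{F}_{\mathcal{S}_{p,n}}$. Then the groups $E_{30}(\mathbb{F}_{\mathcal{S}_{p,n}})$ and $E(\mathbb{F}_{\mathcal{S}_{p,n}})$ are isomorphic. -}

module Defs where

open import Data.Nat using (ℕ; zero; suc; _+_; _*_; _∸_; _^_; _<_; _%_; _≡ᵇ_)
open import Data.Bool using (if_then_else_)
open import Data.Product using (_×_)
open import Data.Unit using (⊤)
open import Relation.Binary.PropositionalEquality using (_≡_)

-- Arithmetic in F_q, with elements represented by naturals in [0, q).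
-- (Used only for q prime, here q = p^2 16^n + 1 ≥ 17.)
module Fq (q : ℕ) where
  red : ℕ → ℕ
  red a = a % suc (q ∸ 1)           -- = a mod q for q ≥ 1

  neg : ℕ → ℕ
  neg a = red (q ∸ a)

  inv : ℕ → ℕ                       -- multiplicative inverse (Fermat), q prime
  inv a = red (a ^ (q ∸ 2))

-- The curve  b·y² = x³ + a·x + c  over F_q (coefficients given as naturals,
-- i.e. already reduced representatives of elements of F_q).
record Curve : Set where
  constructor curve
  field
    b a c : ℕ

data Pt : Set where
  ∞  : Pt
  af : ℕ → ℕ → Pt

OnCurve : ℕ → Curve → Pt → Set
OnCurve q E ∞ = ⊤
OnCurve q (curve b a c) (af x y) =
  x < q × y < q × Fq.red q (b * y * y) ≡ Fq.red q (x * x * x + a * x + c)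

-- The chord-and-tangent group law on  b·y² = x³ + a·x + c  (identity ∞):
--   slope λ = (y₂ - y₁)/(x₂ - x₁)         if x₁ ≠ x₂,
--   slope λ = (3x₁² + a)/(2·b·y₁)          if P = Q, y₁ ≠ 0,
--   P + Q = ∞                              if x₁ = x₂ and y₁ + y₂ = 0,
--   x₃ = b·λ² - x₁ - x₂,  y₃ = λ(x₁ - x₃) - y₁.
add : ℕ → Curve → Pt → Pt → Pt
add q E ∞ Q = Q
add q E (af x₁ y₁) ∞ = af x₁ y₁
add q (curve b a c) (af x₁ y₁) (af x₂ y₂) =
  if x₁ ≡ᵇ x₂
  then (if red (y₁ + y₂) ≡ᵇ 0 then ∞
        else third (red ((3 * x₁ * x₁ + a) * inv (red (2 * b * y₁)))))
  else third (red ((y₂ + neg y₁) * inv (red (x₂ + neg x₁))))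
  where
  open Fq q
  third : ℕ → Pt
  third λ′ = af x₃ (red (λ′ * (x₁ + neg x₃) + neg y₁))
    where x₃ = red (b * λ′ * λ′ + neg x₁ + neg x₂)

record GroupIso (q : ℕ) (E F : Curve) : Set where
  field
    to    : Pt → Pt
    from  : Pt → Pt
    to-on   : ∀ P → OnCurve q E P → OnCurve q F (to P)
    from-on : ∀ P → OnCurve q F P → OnCurve q E (from P)
    from-to : ∀ P → OnCurve q E P → from (to P) ≡ P
    to-from : ∀ P → OnCurve q F P → to (from P) ≡ P
    hom     : ∀ P Q → OnCurve q E P → OnCurve q E Q →
              to (add q E P Q) ≡ add q F (to P) (to Q)

E : ℕ → Curve
E q = curve 1 (q ∸ 1) 0

E₃₀ : ℕ → Curve
E₃₀ q = curve (30 % suc (q ∸ 1)) (q ∸ 1) 0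

S : ℕ → ℕ → ℕ
S p n = p ^ 2 * 16 ^ n + 1

-- Write q = S p n = p²·16ⁿ + 1 and h = (q - 1)/2. If 30 ≡ s² (mod q), then (x, y) ↦ (x, s·y)
-- maps 30y² = x³ - x onto y² = x³ - x and commutes with the chord-and-tangent formulas, since it
-- multiplies every slope by s. By Euler's criterion (Wilson's theorem plus the pairing x ↔ 30/x
-- of the units) it suffices to show 30^h ≡ 1, and 30^h = 2^h · 3^h · 5^h.
--
-- Since q - 1 = i² with i = p·4ⁿ, we have i² ≡ -1 and (1 + i)² ≡ 2i; as 4 ∣ h this gives
-- 2^h ≡ 2^h i^h ≡ (1 + i)^(q-1) ≡ 1. Since p ≡ ±1 (mod 10), q ≡ 2 modulo 3 and modulo 5. For
-- ℓ = 3, 5 the Gauss sum τ = Σ (k/ℓ) ζᵏ in the group ring ℤ[Cℓ] satisfies τ³ = ℓ* τ with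
-- ℓ* = (-1)^((ℓ-1)/2) ℓ, so τ^q = (ℓ*)^h τ; modulo q the Frobenius sends ζᵏ to ζ^(2k), so
-- τ^q ≡ (2/ℓ) τ = -τ. Comparing coefficients of ζ gives (-3)^h ≡ 5^h ≡ -1, and 3^h = (-3)^h as h
-- is even.
module Submission where

open import Data.Nat using (ℕ; suc; _%_; _≤_)
open import Data.Nat.Primality using (Prime)
open import Data.Sum using (_⊎_)
open import Relation.Binary.PropositionalEquality using (_≡_)
open import Defs

module Congruence where

  open import Algebra.Bundles using (CommutativeRing; CommutativeSemiring)
  open import Algebra.Structures using (IsCommutativeMonoid)
  open import Algebra.Structures.Biased using (IsCommutativeSemiringˡ)
  open import Data.Product using (_,_)
  open import Level using (_⊔_)
  open import Relation.Binary.Bundles using (Setoid)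
  open import Relation.Binary.Structures using (IsEquivalence)
  import Relation.Binary.Reasoning.Setoid as SetoidReasoning

  module Modulo {a ℓ} (R : CommutativeRing a ℓ) (c : CommutativeRing.Carrier R) where
    open CommutativeRing R
    open import Algebra.Properties.Ring ring using (-‿distribʳ-*; -‿distribˡ-*; -0#≈0#; -‿+-comm; ⁻¹-anti-homo‿-)
    open import Algebra.Properties.CommutativeSemigroup +-commutativeSemigroup using (interchange)
    open import Algebra.Properties.CommutativeSemigroup *-commutativeSemigroup using (x∙yz≈y∙xz)
    open SetoidReasoning setoid

    infix 4 _∼_
    record _∼_ (x y : Carrier) : Set (a ⊔ ℓ) where
      constructor multiple
      field
        {quotient} : Carrier
        difference : x - y ≈ c * quotient

    private
      -‿split : ∀ x y z → x - z ≈ (x - y) + (y - z)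
      -‿split x y z = sym (begin
        (x - y) + (y - z)   ≈⟨ +-assoc x (- y) (y - z) ⟩
        x + (- y + (y - z)) ≈⟨ +-congˡ (+-assoc (- y) y (- z)) ⟨
        x + ((- y + y) - z) ≈⟨ +-congˡ (+-congʳ (-‿inverseˡ y)) ⟩
        x + (0# - z)        ≈⟨ +-congˡ (+-identityˡ (- z)) ⟩
        x - z               ∎)

      -‿+ : ∀ x y u v → (x + u) - (y + v) ≈ (x - y) + (u - v)
      -‿+ x y u v = begin
        (x + u) - (y + v)    ≈⟨ +-congˡ (-‿+-comm y v) ⟨
        (x + u) + (- y - v)  ≈⟨ interchange x u (- y) (- v) ⟩
        (x - y) + (u - v)    ∎

      -‿* : ∀ x y u v → x * u - y * v ≈ (x - y) * u + y * (u - v)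
      -‿* x y u v = begin
        x * u - y * v                         ≈⟨ -‿split (x * u) (y * u) (y * v) ⟩
        (x * u - y * u) + (y * u - y * v)     ≈⟨ +-cong (+-congˡ (-‿distribˡ-* y u)) (+-congˡ (-‿distribʳ-* y v)) ⟩
        (x * u + - y * u) + (y * u + y * - v) ≈⟨ +-cong (distribʳ u x (- y)) (distribˡ y u (- v)) ⟨
        (x - y) * u + y * (u - v)             ∎

      x-0≈x : ∀ x → x - 0# ≈ x
      x-0≈x x = trans (+-congˡ -0#≈0#) (+-identityʳ x)

    ≈⇒∼ : ∀ {x y} → x ≈ y → x ∼ y
    ≈⇒∼ {x} {y} x≈y = multiple (begin
      x - y  ≈⟨ +-congʳ x≈y ⟩
      y - y  ≈⟨ -‿inverseʳ y ⟩
      0#     ≈⟨ zeroʳ c ⟨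
      c * 0# ∎)

    ∼-refl : ∀ {x} → x ∼ x
    ∼-refl = ≈⇒∼ refl

    ∼-sym : ∀ {x y} → x ∼ y → y ∼ x
    ∼-sym {x} {y} (multiple {w} x-y≈cw) = multiple (begin
      y - x     ≈⟨ ⁻¹-anti-homo‿- x y ⟨
      - (x - y) ≈⟨ -‿cong x-y≈cw ⟩
      - (c * w) ≈⟨ -‿distribʳ-* c w ⟩
      c * - w   ∎)

    ∼-trans : ∀ {x y z} → x ∼ y → y ∼ z → x ∼ z
    ∼-trans {x} {y} {z} (multiple {w} x-y≈cw) (multiple {w′} y-z≈cw′) = multiple (begin
      x - z             ≈⟨ -‿split x y z ⟩
      (x - y) + (y - z) ≈⟨ +-cong x-y≈cw y-z≈cw′ ⟩
      c * w + c * w′    ≈⟨ distribˡ c w w′ ⟨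
      c * (w + w′)      ∎)

    ∼-isEquivalence : IsEquivalence _∼_
    ∼-isEquivalence = record { refl = ∼-refl ; sym = ∼-sym ; trans = ∼-trans }

    ∼-setoid : Setoid a (a ⊔ ℓ)
    ∼-setoid = record { isEquivalence = ∼-isEquivalence }

    module ∼-Reasoning = SetoidReasoning ∼-setoid

    multiple⇒∼0 : ∀ {x w} → x ≈ c * w → x ∼ 0#
    multiple⇒∼0 {x} x≈cw = multiple (trans (x-0≈x x) x≈cw)

    -‿∼0⇒∼ : ∀ {x y} → x - y ∼ 0# → x ∼ y
    -‿∼0⇒∼ {x} {y} (multiple x-y-0≈cw) = multiple (trans (sym (x-0≈x (x - y))) x-y-0≈cw)

    ∼⇒-‿∼0 : ∀ {x y} → x ∼ y → x - y ∼ 0#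
    ∼⇒-‿∼0 (multiple x-y≈cw) = multiple⇒∼0 x-y≈cw

    +-cong-∼ : ∀ {x y u v} → x ∼ y → u ∼ v → x + u ∼ y + v
    +-cong-∼ {x} {y} {u} {v} (multiple {w} x-y≈cw) (multiple {w′} u-v≈cw′) = multiple (begin
      (x + u) - (y + v) ≈⟨ -‿+ x y u v ⟩
      (x - y) + (u - v) ≈⟨ +-cong x-y≈cw u-v≈cw′ ⟩
      c * w + c * w′    ≈⟨ distribˡ c w w′ ⟨
      c * (w + w′)      ∎)

    *-cong-∼ : ∀ {x y u v} → x ∼ y → u ∼ v → x * u ∼ y * v
    *-cong-∼ {x} {y} {u} {v} (multiple {w} x-y≈cw) (multiple {w′} u-v≈cw′) = multiple (begin
      x * u - y * v                ≈⟨ -‿* x y u v ⟩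
      (x - y) * u + y * (u - v)    ≈⟨ +-cong (*-congʳ x-y≈cw) (*-congˡ u-v≈cw′) ⟩
      (c * w) * u + y * (c * w′)   ≈⟨ +-cong (*-assoc c w u) (x∙yz≈y∙xz y c w′) ⟩
      c * (w * u) + c * (y * w′)   ≈⟨ distribˡ c (w * u) (y * w′) ⟨
      c * (w * u + y * w′)         ∎)

    -‿cong-∼ : ∀ {x y} → x ∼ y → - x ∼ - y
    -‿cong-∼ {x} {y} (multiple {w} x-y≈cw) = multiple (begin
      - x - - y  ≈⟨ -‿+-comm x (- y) ⟩
      - (x - y)  ≈⟨ -‿cong x-y≈cw ⟩
      - (c * w)  ≈⟨ -‿distribʳ-* c w ⟩
      c * - w    ∎)

    +-congˡ-∼ : ∀ x {y z} → y ∼ z → x + y ∼ x + z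
    +-congˡ-∼ x = +-cong-∼ (∼-refl {x})

    +-congʳ-∼ : ∀ x {y z} → y ∼ z → y + x ∼ z + x
    +-congʳ-∼ x y∼z = +-cong-∼ y∼z (∼-refl {x})

    *-congˡ-∼ : ∀ x {y z} → y ∼ z → x * y ∼ x * z
    *-congˡ-∼ x = *-cong-∼ (∼-refl {x})

    *-congʳ-∼ : ∀ x {y z} → y ∼ z → y * x ∼ z * x
    *-congʳ-∼ x y∼z = *-cong-∼ y∼z (∼-refl {x})

    private
      isCommutativeMonoid : ∀ (_∙_ : Carrier → Carrier → Carrier) ε →
        (∀ {x y u v} → x ∼ y → u ∼ v → (x ∙ u) ∼ (y ∙ v)) →
        (∀ x y z → ((x ∙ y) ∙ z) ≈ (x ∙ (y ∙ z))) → (∀ x → (ε ∙ x) ≈ x) →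
        (∀ x → (x ∙ ε) ≈ x) → (∀ x y → (x ∙ y) ≈ (y ∙ x)) →
        IsCommutativeMonoid _∼_ _∙_ ε
      isCommutativeMonoid _∙_ ε ∙-cong assoc idˡ idʳ comm = record
        { isMonoid = record
          { isSemigroup = record
            { isMagma = record { isEquivalence = ∼-isEquivalence ; ∙-cong = ∙-cong }
            ; assoc   = λ x y z → ≈⇒∼ (assoc x y z) }
          ; identity = (λ x → ≈⇒∼ (idˡ x)) , (λ x → ≈⇒∼ (idʳ x)) }
        ; comm = λ x y → ≈⇒∼ (comm x y) }

    quotientSemiring : CommutativeSemiring a (a ⊔ ℓ)
    quotientSemiring = record
      { _≈_ = _∼_
      ; isCommutativeSemiring = IsCommutativeSemiringˡ.isCommutativeSemiring record
        { +-isCommutativeMonoid = isCommutativeMonoid _+_ 0# +-cong-∼ +-assoc +-identityˡ +-identityʳ +-comm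
        ; *-isCommutativeMonoid = isCommutativeMonoid _*_ 1# *-cong-∼ *-assoc *-identityˡ *-identityʳ *-comm
        ; distribʳ = λ x y z → ≈⇒∼ (distribʳ x y z)
        ; zeroˡ    = λ x → ≈⇒∼ (zeroˡ x) } }

module Frobenius where

  open import Algebra.Bundles using (CommutativeRing; CommutativeSemiring)
  open import Data.Empty using (⊥-elim)
  open import Data.Fin as Fin using (Fin; toℕ; inject₁; fromℕ)
  open import Data.Fin.Properties using (toℕ-inject₁; toℕ-fromℕ; toℕ<n)
  open import Data.Nat as ℕ using (ℕ; zero; suc; _<_; _∸_; s≤s; z≤n; _!; nonTrivial⇒n>1)
  open import Data.Nat.Combinatorics using (_C_; nCn≡1; k![n∸k]!∣n!)
  open import Data.Nat.Combinatorics.Specification using (nCk≡n!/k![n-k]!)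
  open import Data.Nat.Divisibility using (_∣_; divides; m∣m*n; ∣⇒≤)
  open import Data.Nat.DivMod using (m/n*n≡m)
  open import Data.Nat.Primality using (Prime; euclidsLemma; prime⇒nonTrivial)
  import Data.Nat.Properties as ℕ
  open import Data.Sum using (inj₁; inj₂)
  open import Relation.Binary.PropositionalEquality as ≡ using (_≡_)
  open import Relation.Nullary using (¬_)
  open Congruence

  prime>1 : ∀ {p} → Prime p → 1 < p
  prime>1 {p} pr = nonTrivial⇒n>1 p {{prime⇒nonTrivial pr}}

  p∤m! : ∀ {p} → Prime p → ∀ m → m < p → ¬ p ∣ m !
  p∤m! pr zero    _   p∣1 = ℕ.<⇒≱ (prime>1 pr) (∣⇒≤ p∣1)
  p∤m! pr (suc m) m<p p∣m! with euclidsLemma (suc m) (m !) pr p∣m!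
  ... | inj₁ p∣1+m = ℕ.<⇒≱ m<p (∣⇒≤ p∣1+m)
  ... | inj₂ p∣m!  = p∤m! pr m (ℕ.<-trans (ℕ.n<1+n m) m<p) p∣m!

  p∣p! : ∀ {p} → Prime p → p ∣ p !
  p∣p! {suc p} _ = m∣m*n (p !)

  p∣pCk : ∀ {p k} → Prime p → 0 < k → k < p → p ∣ p C k
  p∣pCk {p} {k} pr 0<k k<p with euclidsLemma (p C k) (k ! ℕ.* (p ∸ k) !) pr p∣C*!*!
    where
    instance _ = k ℕ.!* (p ∸ k) !≢0
    C*!*!≡! : (p C k) ℕ.* (k ! ℕ.* (p ∸ k) !) ≡ p !
    C*!*!≡! = ≡.trans (≡.cong (ℕ._* (k ! ℕ.* (p ∸ k) !)) (nCk≡n!/k![n-k]! (ℕ.<⇒≤ k<p)))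
                      (m/n*n≡m (k![n∸k]!∣n! (ℕ.<⇒≤ k<p)))
    p∣C*!*! : p ∣ (p C k) ℕ.* (k ! ℕ.* (p ∸ k) !)
    p∣C*!*! = ≡.subst (p ∣_) (≡.sym C*!*!≡!) (p∣p! pr)
  ... | inj₁ p∣C = p∣C
  ... | inj₂ p∣!*! with euclidsLemma (k !) ((p ∸ k) !) pr p∣!*!
  ...   | inj₁ p∣k! = ⊥-elim (p∤m! pr k k<p p∣k!)
  ...   | inj₂ p∣[p∸k]! = ⊥-elim (p∤m! pr (p ∸ k) (ℕ.∸-monoʳ-< 0<k (ℕ.<⇒≤ k<p)) p∣[p∸k]!)

  module _ {c ℓ} (S : CommutativeSemiring c ℓ) where
    open CommutativeSemiring S
    open import Algebra.Properties.Semiring.Exp semiring using (_^_)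
    open import Algebra.Properties.Semiring.Mult semiring using (_×_)
    open import Algebra.Properties.Semiring.Sum semiring using (sum)
    open import Algebra.Properties.Monoid.Sum +-monoid using (sum-cong-≋; sum-replicate-zero; sum-init-last)
    import Algebra.Properties.CommutativeSemiring.Binomial S as Binomial
    open import Relation.Binary.Reasoning.Setoid setoid

    freshman's-dream : ∀ n → (∀ k → 0 < k → k < suc n → ∀ z → (suc n C k) × z ≈ 0#) →
                       ∀ x y → (x + y) ^ suc n ≈ x ^ suc n + y ^ suc n
    freshman's-dream n C≈0 x y = begin
      (x + y) ^ suc n                                           ≈⟨ Binomial.theorem (suc n) x y ⟩
      term Fin.zero + sum (λ i → term (Fin.suc i))                ≈⟨ +-congˡ (sum-init-last (λ i → term (Fin.suc i))) ⟩
      term Fin.zero + (sum middle + term (Fin.suc (fromℕ n)))     ≈⟨ +-congˡ (+-congʳ middle≈0) ⟩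
      term Fin.zero + (0# + term (fromℕ (suc n)))                 ≈⟨ +-cong first (+-identityˡ _) ⟩
      y ^ suc n + term (fromℕ (suc n))                            ≈⟨ +-congˡ last ⟩
      y ^ suc n + x ^ suc n                                       ≈⟨ +-comm _ _ ⟩
      x ^ suc n + y ^ suc n                                       ∎
      where
      term = Binomial.binomialTerm x y (suc n)
      middle : Fin n → Carrier
      middle i = term (Fin.suc (inject₁ i))
      middle≈0 : sum middle ≈ 0#
      middle≈0 = trans (sum-cong-≋ λ i → C≈0 (suc (toℕ (inject₁ i))) (s≤s z≤n)
                         (s≤s (ℕ.≤-trans (s≤s (ℕ.≤-reflexive (toℕ-inject₁ i))) (toℕ<n i))) _)
                       (sum-replicate-zero n)
      first : term Fin.zero ≈ y ^ suc n
      first = trans (+-identityʳ _) (*-identityˡ _)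
      last : term (fromℕ (suc n)) ≈ x ^ suc n
      last = begin
        (suc n C toℕ (fromℕ (suc n))) × (x ^ toℕ (fromℕ (suc n)) * y ^ (suc n ∸ toℕ (fromℕ (suc n))))
          ≡⟨ ≡.cong (λ k → (suc n C k) × (x ^ k * y ^ (suc n ∸ k))) (toℕ-fromℕ (suc n)) ⟩
        (suc n C suc n) × (x ^ suc n * y ^ (suc n ∸ suc n))
          ≡⟨ ≡.cong₂ (λ a b → a × (x ^ suc n * y ^ b)) (nCn≡1 (suc n)) (ℕ.n∸n≡0 (suc n)) ⟩
        1 × (x ^ suc n * 1#)  ≈⟨ +-identityʳ _ ⟩
        x ^ suc n * 1#        ≈⟨ *-identityʳ _ ⟩
        x ^ suc n             ∎

  module _ {a ℓ} (R : CommutativeRing a ℓ) where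
    open CommutativeRing R
    open import Algebra.Properties.Semiring.Exp semiring using (_^_)
    open import Algebra.Properties.Semiring.Mult semiring using (_×_; ×-assoc-*)
    open import Algebra.Properties.Monoid.Mult +-monoid using (×-assocˡ; ×-congˡ; ×-congʳ)
    open import Relation.Binary.Reasoning.Setoid setoid

    frobenius : ∀ {p} → Prime p → ∀ x y → Modulo._∼_ R (p × 1#) ((x + y) ^ p) (x ^ p + y ^ p)
    frobenius {suc n} pr x y =
      ≡.subst₂ (Modulo._∼_ R (p × 1#)) (^≡ (x + y) p) (≡.cong₂ _+_ (^≡ x p) (^≡ y p))
               (freshman's-dream Q n C×≈0 x y)
      where
      p = suc n
      Q = Modulo.quotientSemiring R (p × 1#)
      module Q = CommutativeSemiring Q
      open import Algebra.Properties.Semiring.Exp Q.semiring using () renaming (_^_ to _^Q_)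
      open import Algebra.Properties.Semiring.Mult Q.semiring using () renaming (_×_ to _×Q_)

      ^≡ : ∀ z k → z ^Q k ≡ z ^ k
      ^≡ z zero    = ≡.refl
      ^≡ z (suc k) = ≡.cong (z *_) (^≡ z k)

      ×≡ : ∀ k z → k ×Q z ≡ k × z
      ×≡ zero    z = ≡.refl
      ×≡ (suc k) z = ≡.cong (z +_) (×≡ k z)

      C×≈0 : ∀ k → 0 < k → k < p → ∀ z → Q._≈_ ((p C k) ×Q z) 0#
      C×≈0 k 0<k k<p z with p∣pCk pr 0<k k<p
      ... | divides j pCk≡jp rewrite pCk≡jp | ×≡ (j ℕ.* p) z = Modulo.multiple⇒∼0 R (p × 1#) (begin
        (j ℕ.* p) × z     ≈⟨ ×-congˡ (ℕ.*-comm j p) ⟩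
        (p ℕ.* j) × z     ≈⟨ ×-assocˡ z p j ⟨
        p × (j × z)       ≈⟨ ×-congʳ p (*-identityˡ (j × z)) ⟨
        p × (1# * j × z)  ≈⟨ ×-assoc-* p 1# (j × z) ⟨
        p × 1# * j × z    ∎)

module IntegersModulo where

  open import Algebra.Bundles using (CommutativeRing)
  open import Data.Empty using (⊥-elim)
  open import Data.Integer as ℤ using (ℤ; +_; -_; _+_; _*_; _-_; _^_; ∣_∣; 0ℤ; 1ℤ; _⊖_)
  import Data.Integer.Properties as ℤ
  open import Data.Integer.Tactic.RingSolver using (solve-∀)
  import Data.Integer.Divisibility.Signed as ℤ∣
  open import Data.Nat as ℕ using (ℕ; zero; suc; _<_; _≤_; _%_; _/_; _∸_; NonZero)
  open import Data.Nat.Divisibility as ℕ using (divides; n∣m⇒m%n≡0)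
  open import Data.Nat.DivMod using (m%n<n; m≡m%n+[m/n]*n; m<n⇒m%n≡m)
  open import Data.Nat.Primality using (Prime; euclidsLemma)
  import Data.Nat.Properties as ℕ
  open import Level using (0ℓ)
  open import Data.Sum using (_⊎_; inj₁; inj₂)
  open import Relation.Binary.PropositionalEquality
  open import Relation.Nullary using (¬_)
  open Congruence
  open Frobenius

  ℤ-ring : CommutativeRing 0ℓ 0ℓ
  ℤ-ring = ℤ.+-*-commutativeRing

  ^-distribʳ-* : ∀ a b n → (a * b) ^ n ≡ a ^ n * b ^ n
  ^-distribʳ-* a b zero    = refl
  ^-distribʳ-* a b (suc n) = trans (cong (a * b *_) (^-distribʳ-* a b n)) (interchange a b (a ^ n) (b ^ n))
    where
    interchange : ∀ a b c d → a * b * (c * d) ≡ a * c * (b * d)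
    interchange = solve-∀

  [-a]^[2k]≡a^[2k] : ∀ a k → (- a) ^ (2 ℕ.* k) ≡ a ^ (2 ℕ.* k)
  [-a]^[2k]≡a^[2k] a k = begin
    (- a) ^ (2 ℕ.* k)  ≡⟨ ℤ.^-*-assoc (- a) 2 k ⟨
    ((- a) ^ 2) ^ k    ≡⟨ cong (_^ k) ([-a]²≡a² a) ⟩
    (a ^ 2) ^ k        ≡⟨ ℤ.^-*-assoc a 2 k ⟩
    a ^ (2 ℕ.* k)      ∎
    where
    open ≡-Reasoning
    [-a]²≡a² : ∀ a → (- a) * ((- a) * 1ℤ) ≡ a * (a * 1ℤ)
    [-a]²≡a² = solve-∀

  pos-^ : ∀ a k → + (a ℕ.^ k) ≡ (+ a) ^ k
  pos-^ a zero    = refl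
  pos-^ a (suc k) = trans (ℤ.pos-* a (a ℕ.^ k)) (cong (+ a *_) (pos-^ a k))

  module ℤMod (N : ℕ) where
    open Modulo ℤ-ring (+ N) public

    ^-cong-∼ : ∀ {a b} n → a ∼ b → a ^ n ∼ b ^ n
    ^-cong-∼ zero    _   = ∼-refl
    ^-cong-∼ (suc n) a∼b = *-cong-∼ a∼b (^-cong-∼ n a∼b)

    ∼0⇒∣ : ∀ {a} → a ∼ 0ℤ → N ℕ.∣ ∣ a ∣
    ∼0⇒∣ {a} (multiple {w} a-0≡Nw) = divides ∣ w ∣ (begin
      ∣ a ∣          ≡⟨ cong ∣_∣ (ℤ.+-identityʳ a) ⟨
      ∣ a - 0ℤ ∣     ≡⟨ cong ∣_∣ a-0≡Nw ⟩
      ∣ + N * w ∣    ≡⟨ ℤ.abs-* (+ N) w ⟩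
      N ℕ.* ∣ w ∣    ≡⟨ ℕ.*-comm N ∣ w ∣ ⟩
      ∣ w ∣ ℕ.* N    ∎)
      where open ≡-Reasoning

    ∣⇒∼0 : ∀ {a} → N ℕ.∣ ∣ a ∣ → a ∼ 0ℤ
    ∣⇒∼0 {a} N∣a = multiple⇒∼0 (trans equality (ℤ.*-comm quotient (+ N)))
      where open ℤ∣._∣_ (ℤ∣.∣ᵤ⇒∣ {+ N} {a} N∣a)

    N∼0 : + N ∼ 0ℤ
    N∼0 = multiple⇒∼0 (sym (ℤ.*-identityʳ (+ N)))

    ∸-∼ : ∀ {a} → a ≤ N → + (N ∸ a) ∼ - + a
    ∸-∼ {a} a≤N = begin
      + (N ∸ a)     ≡⟨ ℤ.⊖-≥ a≤N ⟨
      N ⊖ a         ≡⟨ ℤ.m-n≡m⊖n N a ⟨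
      + N - + a     ≈⟨ +-cong-∼ N∼0 (∼-refl { - + a }) ⟩
      0ℤ - + a      ≡⟨ ℤ.+-identityˡ (- + a) ⟩
      - + a         ∎
      where open ∼-Reasoning

    module _ .{{_ : NonZero N}} where

      %-∼ : ∀ a → + (a % N) ∼ + a
      %-∼ a = multiple {quotient = - + (a / N)} (begin
        + (a % N) - + a                            ≡⟨ cong (λ b → + (a % N) - + b) (m≡m%n+[m/n]*n a N) ⟩
        + (a % N) - + (a % N ℕ.+ a / N ℕ.* N)      ≡⟨ cong (λ b → + (a % N) - b) (ℤ.pos-+ (a % N) (a / N ℕ.* N)) ⟩
        + (a % N) - (+ (a % N) + + (a / N ℕ.* N))  ≡⟨ cong (λ b → + (a % N) - (+ (a % N) + b)) (ℤ.pos-* (a / N) N) ⟩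
        + (a % N) - (+ (a % N) + + (a / N) * + N)  ≡⟨ r-[r+q*n]≡n*-q (+ (a % N)) (+ (a / N)) (+ N) ⟩
        + N * - + (a / N)                          ∎)
        where
        open ≡-Reasoning
        r-[r+q*n]≡n*-q : ∀ r q n → r - (r + q * n) ≡ n * - q
        r-[r+q*n]≡n*-q = solve-∀

      private
        ∼⇒≡-≤ : ∀ {a b} → a ≤ b → b < N → + a ∼ + b → a ≡ b
        ∼⇒≡-≤ {a} {b} a≤b b<N a∼b = ℕ.≤-antisym a≤b (ℕ.m∸n≡0⇒m≤n b∸a≡0)
          where
          N∣b∸a : N ℕ.∣ b ∸ a
          N∣b∸a = subst (N ℕ.∣_) (trans (cong ∣_∣ (ℤ.m-n≡m⊖n a b)) (ℤ.∣⊖∣-≤ a≤b))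
                        (∼0⇒∣ (multiple⇒∼0 (_∼_.difference a∼b)))
          b∸a≡0 : b ∸ a ≡ 0
          b∸a≡0 = trans (sym (m<n⇒m%n≡m (ℕ.≤-<-trans (ℕ.m∸n≤m b a) b<N))) (n∣m⇒m%n≡0 (b ∸ a) N N∣b∸a)

      ∼⇒≡ : ∀ {a b} → a < N → b < N → + a ∼ + b → a ≡ b
      ∼⇒≡ {a} {b} a<N b<N a∼b with ℕ.≤-total a b
      ... | inj₁ a≤b = ∼⇒≡-≤ a≤b b<N a∼b
      ... | inj₂ b≤a = sym (∼⇒≡-≤ b≤a a<N (∼-sym a∼b))

      ∼⇒%≡ : ∀ {a b} → + a ∼ + b → a % N ≡ b % N
      ∼⇒%≡ {a} {b} a∼b = ∼⇒≡ (m%n<n a N) (m%n<n b N) (∼-trans (%-∼ a) (∼-trans a∼b (∼-sym (%-∼ b))))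

  module ℤModPrime (m : ℕ) (prime : Prime (suc m)) where
    N : ℕ
    N = suc m

    open ℤMod N public

    *∼0⇒∼0⊎∼0 : ∀ {a b} → a * b ∼ 0ℤ → a ∼ 0ℤ ⊎ b ∼ 0ℤ
    *∼0⇒∼0⊎∼0 {a} {b} ab∼0 with euclidsLemma ∣ a ∣ ∣ b ∣ prime (subst (N ℕ.∣_) (ℤ.abs-* a b) (∼0⇒∣ ab∼0))
    ... | inj₁ N∣a = inj₁ (∣⇒∼0 N∣a)
    ... | inj₂ N∣b = inj₂ (∣⇒∼0 N∣b)

    *-cancelˡ-∼ : ∀ {a b c} → ¬ a ∼ 0ℤ → a * b ∼ a * c → b ∼ c
    *-cancelˡ-∼ {a} {b} {c} a≁0 ab∼ac with *∼0⇒∼0⊎∼0 a[b-c]∼0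
      where
      a[b-c]∼0 : a * (b - c) ∼ 0ℤ
      a[b-c]∼0 = subst (_∼ 0ℤ) (sym (trans (ℤ.*-distribˡ-+ a b (- c)) (cong (_+_ (a * b)) (sym (ℤ.neg-distribʳ-* a c)))))
                       (∼⇒-‿∼0 ab∼ac)
    ... | inj₁ a∼0   = ⊥-elim (a≁0 a∼0)
    ... | inj₂ b-c∼0 = -‿∼0⇒∼ b-c∼0

    frobenius-ℤ : ∀ a b → (a + b) ^ N ∼ a ^ N + b ^ N
    frobenius-ℤ a b = subst (λ c → Modulo._∼_ ℤ-ring c ((a + b) ^ N) (a ^ N + b ^ N)) (×1≡ N)
                        (subst₂ (Modulo._∼_ ℤ-ring (N × 1ℤ)) (^≡ (a + b) N) (cong₂ _+_ (^≡ a N) (^≡ b N))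
                                (frobenius ℤ-ring prime a b))
      where
      open import Algebra.Properties.Semiring.Exp ℤ.+-*-semiring using () renaming (_^_ to _^′_)
      open import Algebra.Properties.Semiring.Mult ℤ.+-*-semiring using (_×_)
      ^≡ : ∀ x n → x ^′ n ≡ x ^ n
      ^≡ x zero    = refl
      ^≡ x (suc n) = cong (x *_) (^≡ x n)
      ×1≡ : ∀ n → n × 1ℤ ≡ + n
      ×1≡ zero    = refl
      ×1≡ (suc n) = cong (_+_ 1ℤ) (×1≡ n)

    fermat : ∀ a → (+ a) ^ N ∼ + a
    fermat zero    = ≈⇒∼ (ℤ.*-zeroˡ ((+ 0) ^ m))
    fermat (suc a) = begin
      (1ℤ + + a) ^ N      ≈⟨ frobenius-ℤ 1ℤ (+ a) ⟩
      1ℤ ^ N + (+ a) ^ N  ≈⟨ +-cong-∼ (≈⇒∼ (ℤ.^-zeroˡ N)) (fermat a) ⟩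
      1ℤ + + a            ∎
      where open ∼-Reasoning

    fermat-^m : ∀ {a} → ¬ + a ∼ 0ℤ → (+ a) ^ m ∼ 1ℤ
    fermat-^m {a} a≁0 = *-cancelˡ-∼ a≁0 (∼-trans (fermat a) (≈⇒∼ (sym (ℤ.*-identityʳ (+ a)))))

module Pairing where

  open import Data.Empty using (⊥-elim)
  open import Data.Integer as ℤ using (ℤ; +_; _*_; _^_)
  import Data.Integer.Properties as ℤ
  open import Data.List using (List; []; _∷_; _++_; length)
  open import Data.List.Membership.Propositional using (_∈_; _∉_)
  open import Data.List.Membership.Propositional.Properties using (∈-∃++)
  open import Data.List.Relation.Binary.Permutation.Propositional using (_↭_; prep; ↭-sym; ↭⇒↭ₛ)
  open import Data.List.Relation.Binary.Permutation.Propositional.Properties using (shift; ∈-resp-↭; ↭-length)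
  import Data.List.Relation.Binary.Permutation.Setoid.Properties as PermutationSetoid
  open import Data.List.Relation.Unary.Any using (here; there)
  open import Data.List.Relation.Unary.AllPairs using (_∷_)
  open import Data.List.Relation.Unary.Unique.Propositional using (Unique)
  open import Data.List.Relation.Unary.Unique.Propositional.Properties using (Unique[x∷xs]⇒x∉xs)
  open import Data.Nat as ℕ using (ℕ; zero; suc)
  open import Data.Nat.ListAction using (product)
  open import Data.Nat.ListAction.Properties using (product-↭)
  import Data.Nat.Properties as ℕ
  open import Data.Product using (∃-syntax; _×_; _,_; proj₁; proj₂)
  open import Function using (_∘_)
  open import Relation.Binary.PropositionalEquality
  open IntegersModulo

  module PairedProduct (N : ℕ) (σ : ℕ → ℕ) (c : ℤ) where
    open ℤMod N

    record Paired (L : List ℕ) : Set where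
      field
        closed           : ∀ {x} → x ∈ L → σ x ∈ L
        involutive       : ∀ {x} → x ∈ L → σ (σ x) ≡ x
        fixed-point-free : ∀ {x} → x ∈ L → σ x ≢ x
        pair-product     : ∀ {x} → x ∈ L → + (x ℕ.* σ x) ∼ c

    private
      Unique-resp-↭ : ∀ {xs ys} → xs ↭ ys → Unique xs → Unique ys
      Unique-resp-↭ p = PermutationSetoid.Unique-resp-↭ (setoid ℕ) (↭⇒↭ₛ p)

      σ-injective : ∀ {L} → Paired L → ∀ {x y} → x ∈ L → y ∈ L → σ x ≡ σ y → x ≡ y
      σ-injective paired x∈ y∈ σx≡σy = trans (sym (involutive x∈)) (trans (cong σ σx≡σy) (involutive y∈))
        where open Paired paired

      σx∈tail : ∀ {x L} → Paired (x ∷ L) → σ x ∈ L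
      σx∈tail paired with Paired.closed paired (here refl)
      ... | here σx≡x = ⊥-elim (Paired.fixed-point-free paired (here refl) σx≡x)
      ... | there σx∈ = σx∈

    module _ {x rest L} (L↭ : x ∷ L ↭ x ∷ σ x ∷ rest) (unique : Unique (x ∷ L)) (paired : Paired (x ∷ L)) where
      open Paired paired

      private
        unique′ : Unique (x ∷ σ x ∷ rest)
        unique′ = Unique-resp-↭ L↭ unique
        x∉ : x ∉ σ x ∷ rest
        x∉ = Unique[x∷xs]⇒x∉xs unique′
        σx∉ : σ x ∉ rest
        σx∉ with _ ∷ unique″ ← unique′ = Unique[x∷xs]⇒x∉xs unique″
        ∈-whole : ∀ {y} → y ∈ rest → y ∈ x ∷ L
        ∈-whole y∈ = ∈-resp-↭ (↭-sym L↭) (there (there y∈))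

      unique-rest : Unique rest
      unique-rest with _ ∷ _ ∷ unique″ ← unique′ = unique″

      paired-rest : Paired rest
      paired-rest = record
        { closed           = closed-rest
        ; involutive       = involutive ∘ ∈-whole
        ; fixed-point-free = fixed-point-free ∘ ∈-whole
        ; pair-product     = pair-product ∘ ∈-whole }
        where
        closed-rest : ∀ {y} → y ∈ rest → σ y ∈ rest
        closed-rest {y} y∈ with ∈-resp-↭ L↭ (closed (∈-whole y∈))
        ... | here σy≡x =
          ⊥-elim (σx∉ (subst (_∈ rest) (σ-injective paired (∈-whole y∈) (closed (here refl)) (trans σy≡x (sym (involutive (here refl))))) y∈))
        ... | there (here σy≡σx) = ⊥-elim (x∉ (there (subst (_∈ rest) (σ-injective paired (∈-whole y∈) (here refl) σy≡σx) y∈)))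
        ... | there (there σy∈) = σy∈

    paired-product : ∀ n L → length L ≡ n → Unique L → Paired L →
                     ∃[ k ] n ≡ k ℕ.* 2 × + product L ∼ c ^ k
    paired-product zero          []      _   _      _      = 0 , refl , ∼-refl
    paired-product (suc zero)    (x ∷ []) _  _      paired with () ← σx∈tail paired
    paired-product (suc (suc n)) (x ∷ L) len unique paired with ys , zs , refl ← ∈-∃++ (σx∈tail paired) =
      suc k , cong (suc ∘ suc) n≡2k , (begin
        + product (x ∷ L)                        ≡⟨ cong +_ (product-↭ L↭) ⟩
        + (x ℕ.* (σ x ℕ.* product rest))         ≡⟨ cong +_ (ℕ.*-assoc x (σ x) (product rest)) ⟨
        + (x ℕ.* σ x ℕ.* product rest)           ≡⟨ ℤ.pos-* (x ℕ.* σ x) (product rest) ⟩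
        + (x ℕ.* σ x) * + product rest           ≈⟨ *-cong-∼ (Paired.pair-product paired (here refl)) rest-product ⟩
        c * c ^ k                                ∎)
      where
      open ∼-Reasoning
      rest : List ℕ
      rest = ys ++ zs
      L↭ : x ∷ L ↭ x ∷ σ x ∷ rest
      L↭ = prep x (shift (σ x) ys zs)
      length-rest : length rest ≡ n
      length-rest = ℕ.suc-injective (ℕ.suc-injective (trans (sym (↭-length L↭)) len))
      recursive = paired-product n rest length-rest (unique-rest L↭ unique paired) (paired-rest L↭ unique paired)
      k = proj₁ recursive
      n≡2k = proj₁ (proj₂ recursive)
      rest-product = proj₂ (proj₂ recursive)

module Euler where

  open import Data.Empty using (⊥-elim)
  open import Data.Fin using (Fin; toℕ; fromℕ<)
  open import Data.Fin.Properties using (any?; toℕ<n; toℕ-fromℕ<)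
  open import Data.Integer as ℤ using (ℤ; +_; -_; _+_; _*_; _-_; _^_; 0ℤ; 1ℤ; -1ℤ)
  import Data.Integer.Properties as ℤ
  open import Data.Integer.Tactic.RingSolver using (solve-∀)
  open import Data.List using (List; applyDownFrom)
  open import Data.List.Properties using (length-applyDownFrom)
  open import Data.List.Membership.Propositional using (_∈_)
  open import Data.List.Membership.Propositional.Properties using (∈-applyDownFrom⁺; ∈-applyDownFrom⁻)
  open import Data.List.Relation.Unary.Unique.Propositional using (Unique)
  open import Data.List.Relation.Unary.Unique.Propositional.Properties using (applyDownFrom⁺₁)
  open import Data.Nat as ℕ using (ℕ; zero; suc; _<_; _≤_; _%_; _∸_; _!; s≤s; z≤n; >-nonZero)
  open import Data.Nat.Divisibility using (∣⇒≤)
  open import Data.Nat.DivMod using (m%n<n; %-distribˡ-*)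
  open import Data.Nat.ListAction using (product)
  open import Data.Nat.Primality using (Prime; ¬prime[1])
  import Data.Nat.Properties as ℕ
  open import Data.Product using (∃-syntax; _×_; _,_; proj₁; proj₂)
  open import Data.Sum using (_⊎_; inj₁; inj₂)
  open import Relation.Binary.PropositionalEquality
  open import Relation.Nullary using (¬_; yes; no)
  open Frobenius using (prime>1)
  open IntegersModulo
  open Pairing

  module Division (m : ℕ) (prime : Prime (suc m)) where
    open ℤModPrime m prime public

    m≡1+[m∸1] : m ≡ suc (m ∸ 1)
    m≡1+[m∸1] = sym (ℕ.suc-pred m {{>-nonZero (ℕ.≤-pred (prime>1 prime))}})

    ≢0⇒≁0 : ∀ {x} → 0 < x → x < N → ¬ + x ∼ 0ℤ
    ≢0⇒≁0 {x} 0<x x<N x∼0 = ℕ.<⇒≱ x<N (∣⇒≤ {{>-nonZero 0<x}} (∼0⇒∣ x∼0))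

    ≁0⇒≢0 : ∀ {x} → ¬ + x ∼ 0ℤ → 0 < x
    ≁0⇒≢0 {zero}  0≁0 = ⊥-elim (0≁0 ∼-refl)
    ≁0⇒≢0 {suc x} _   = s≤s z≤n

    infixl 7 _÷_
    _÷_ : ℕ → ℕ → ℕ
    c ÷ x = (c ℕ.* x ℕ.^ (m ∸ 1)) % N

    ÷<N : ∀ c x → c ÷ x < N
    ÷<N c x = m%n<n (c ℕ.* x ℕ.^ (m ∸ 1)) N

    *-÷ : ∀ c {x} → ¬ + x ∼ 0ℤ → + (x ℕ.* (c ÷ x)) ∼ + c
    *-÷ c {x} x≁0 = begin
      + (x ℕ.* (c ÷ x))                       ≡⟨ ℤ.pos-* x (c ÷ x) ⟩
      + x * + (c ÷ x)                         ≈⟨ *-congˡ-∼ (+ x) (%-∼ (c ℕ.* x ℕ.^ (m ∸ 1))) ⟩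
      + x * + (c ℕ.* x ℕ.^ (m ∸ 1))           ≡⟨ cong (+ x *_) (trans (ℤ.pos-* c _) (cong (+ c *_) (pos-^ x (m ∸ 1)))) ⟩
      + x * (+ c * (+ x) ^ (m ∸ 1))           ≡⟨ x*[c*y]≡c*[x*y] (+ x) (+ c) ((+ x) ^ (m ∸ 1)) ⟩
      + c * (+ x) ^ suc (m ∸ 1)               ≡⟨ cong (λ k → + c * (+ x) ^ k) m≡1+[m∸1] ⟨
      + c * (+ x) ^ m                         ≈⟨ *-congˡ-∼ (+ c) (fermat-^m x≁0) ⟩
      + c * 1ℤ                                ≡⟨ ℤ.*-identityʳ (+ c) ⟩
      + c                                     ∎
      where
      open ∼-Reasoning
      x*[c*y]≡c*[x*y] : ∀ x c y → x * (c * y) ≡ c * (x * y)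
      x*[c*y]≡c*[x*y] = solve-∀

    ÷-≁0 : ∀ {c x} → ¬ + c ∼ 0ℤ → ¬ + x ∼ 0ℤ → ¬ + (c ÷ x) ∼ 0ℤ
    ÷-≁0 {c} {x} c≁0 x≁0 c÷x∼0 = c≁0 (begin
      + c                   ≈⟨ *-÷ c x≁0 ⟨
      + (x ℕ.* (c ÷ x))     ≡⟨ ℤ.pos-* x (c ÷ x) ⟩
      + x * + (c ÷ x)       ≈⟨ *-congˡ-∼ (+ x) c÷x∼0 ⟩
      + x * 0ℤ              ≡⟨ ℤ.*-zeroʳ (+ x) ⟩
      0ℤ                    ∎)
      where open ∼-Reasoning

    ÷-unique : ∀ {c x y} → ¬ + x ∼ 0ℤ → y < N → + (x ℕ.* y) ∼ + c → c ÷ x ≡ y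
    ÷-unique {c} {x} {y} x≁0 y<N xy∼c = ∼⇒≡ (÷<N c x) y<N (*-cancelˡ-∼ x≁0 (begin
      + x * + (c ÷ x)      ≡⟨ ℤ.pos-* x (c ÷ x) ⟨
      + (x ℕ.* (c ÷ x))    ≈⟨ *-÷ c x≁0 ⟩
      + c                  ≈⟨ xy∼c ⟨
      + (x ℕ.* y)          ≡⟨ ℤ.pos-* x y ⟩
      + x * + y            ∎))
      where open ∼-Reasoning

    ÷-involutive : ∀ {c x} → ¬ + c ∼ 0ℤ → ¬ + x ∼ 0ℤ → x < N → c ÷ (c ÷ x) ≡ x
    ÷-involutive {c} {x} c≁0 x≁0 x<N =
      ÷-unique (÷-≁0 c≁0 x≁0) x<N (subst (_∼ + c) (cong +_ (ℕ.*-comm x (c ÷ x))) (*-÷ c x≁0))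

    m∼-1 : + m ∼ -1ℤ
    m∼-1 = multiple {quotient = 1ℤ} (trans (ℤ.+-comm (+ m) 1ℤ) (sym (ℤ.*-identityʳ (+ N))))

    x²∼1⇒x≡1⊎x≡m : ∀ {x} → x < N → + (x ℕ.* x) ∼ 1ℤ → x ≡ 1 ⊎ x ≡ m
    x²∼1⇒x≡1⊎x≡m {x} x<N x²∼1 with *∼0⇒∼0⊎∼0 [x-1][x+1]∼0
      where
      [x-1][x+1]∼0 : (+ x - 1ℤ) * (+ x + 1ℤ) ∼ 0ℤ
      [x-1][x+1]∼0 = subst (_∼ 0ℤ) (trans (cong (_- 1ℤ) (ℤ.pos-* x x)) (difference-of-squares (+ x))) (∼⇒-‿∼0 x²∼1)
        where
        difference-of-squares : ∀ x → x * x - 1ℤ ≡ (x - 1ℤ) * (x + 1ℤ)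
        difference-of-squares = solve-∀
    ... | inj₁ x-1∼0 = inj₁ (∼⇒≡ x<N (prime>1 prime) (-‿∼0⇒∼ x-1∼0))
    ... | inj₂ x+1∼0 = inj₂ (∼⇒≡ x<N (ℕ.n<1+n m) (∼-trans (-‿∼0⇒∼ { y = -1ℤ } x+1∼0) (∼-sym m∼-1)))

  interval : ℕ → ℕ → List ℕ
  interval d n = applyDownFrom (d ℕ.+_) n

  ∈-interval⁻ : ∀ {d n x} → x ∈ interval d n → d ≤ x × x < d ℕ.+ n
  ∈-interval⁻ {d} x∈ with i , i<n , refl ← ∈-applyDownFrom⁻ (d ℕ.+_) x∈ = ℕ.m≤m+n d i , ℕ.+-monoʳ-< d i<n

  ∈-interval⁺ : ∀ {d n x} → d ≤ x → x < d ℕ.+ n → x ∈ interval d n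
  ∈-interval⁺ {d} {n} {x} d≤x x<d+n =
    subst (_∈ interval d n) (ℕ.m+[n∸m]≡n d≤x) (∈-applyDownFrom⁺ (d ℕ.+_) (ℕ.+-cancelˡ-< d _ _ x<d+[x∸d]))
    where
    x<d+[x∸d] : d ℕ.+ (x ∸ d) < d ℕ.+ n
    x<d+[x∸d] = subst (_< d ℕ.+ n) (sym (ℕ.m+[n∸m]≡n d≤x)) x<d+n

  interval-unique : ∀ d n → Unique (interval d n)
  interval-unique d n = applyDownFrom⁺₁ (d ℕ.+_) n (λ j<i _ d+i≡d+j → ℕ.<⇒≢ j<i (sym (ℕ.+-cancelˡ-≡ d _ _ d+i≡d+j)))

  product-interval-1 : ∀ n → product (interval 1 n) ≡ n !
  product-interval-1 zero    = refl
  product-interval-1 (suc n) = cong (ℕ._*_ (suc n)) (product-interval-1 n)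

  product-interval-2 : ∀ n → product (interval 2 n) ≡ suc n !
  product-interval-2 zero    = refl
  product-interval-2 (suc n) = cong (ℕ._*_ (2 ℕ.+ n)) (product-interval-2 n)

  module WilsonOdd (k : ℕ) (prime : Prime (3 ℕ.+ k)) where
    m : ℕ
    m = 2 ℕ.+ k

    open Division m prime

    open PairedProduct N (1 ÷_) 1ℤ

    private
      ¬1∨m : ∀ {x} → 1 < x → x < m → ¬ (x ≡ 1 ⊎ x ≡ m)
      ¬1∨m 1<x _   (inj₁ refl) = ℕ.<-irrefl refl 1<x
      ¬1∨m _   x<m (inj₂ refl) = ℕ.<-irrefl refl x<m

      1∨m⇒square∼1 : ∀ {y} → y ≡ 1 ⊎ y ≡ m → + (y ℕ.* y) ∼ 1ℤ
      1∨m⇒square∼1 (inj₁ refl) = ∼-refl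
      1∨m⇒square∼1 (inj₂ refl) = subst (_∼ 1ℤ) (sym (ℤ.pos-* m m)) (*-cong-∼ m∼-1 m∼-1)

      1≁0 : ¬ + 1 ∼ 0ℤ
      1≁0 = ≢0⇒≁0 (s≤s z≤n) (prime>1 prime)

      module _ {x} (x∈ : x ∈ interval 2 k) where
        1<x = proj₁ (∈-interval⁻ x∈)
        x<m = proj₂ (∈-interval⁻ x∈)
        x<N = ℕ.m<n⇒m<1+n x<m
        x≁0 = ≢0⇒≁0 (ℕ.<-trans (s≤s z≤n) 1<x) x<N

        x*[1÷x]∼1 : + (x ℕ.* (1 ÷ x)) ∼ 1ℤ
        x*[1÷x]∼1 = *-÷ 1 x≁0

        1÷1÷x≡x : 1 ÷ (1 ÷ x) ≡ x
        1÷1÷x≡x = ÷-involutive 1≁0 x≁0 x<N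

        1÷x≢x : 1 ÷ x ≢ x
        1÷x≢x y≡x = ¬1∨m 1<x x<m (x²∼1⇒x≡1⊎x≡m x<N (subst (λ y → + (x ℕ.* y) ∼ 1ℤ) y≡x x*[1÷x]∼1))

        1÷x∈interval : 1 ÷ x ∈ interval 2 k
        1÷x∈interval = ∈-interval⁺ (ℕ.≤∧≢⇒< 0<y (λ 1≡y → ¬1∨m′ (inj₁ (sym 1≡y)))) (ℕ.≤∧≢⇒< y≤m (λ y≡m → ¬1∨m′ (inj₂ y≡m)))
          where
          y = 1 ÷ x
          y≁0 = ÷-≁0 1≁0 x≁0
          0<y = ≁0⇒≢0 y≁0
          y≤m = ℕ.≤-pred (÷<N 1 x)
          ¬1∨m′ : ¬ (y ≡ 1 ⊎ y ≡ m)
          ¬1∨m′ y≡1∨m = ¬1∨m 1<x x<m (subst (λ z → z ≡ 1 ⊎ z ≡ m) (sym x≡y) y≡1∨m)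
            where
            x≡y : x ≡ y
            x≡y = trans (sym 1÷1÷x≡x) (÷-unique y≁0 (÷<N 1 x) (1∨m⇒square∼1 y≡1∨m))

    paired-by-1÷ : Paired (interval 2 k)
    paired-by-1÷ = record
      { closed           = 1÷x∈interval
      ; involutive       = 1÷1÷x≡x
      ; fixed-point-free = 1÷x≢x
      ; pair-product     = x*[1÷x]∼1 }

    wilson-odd : + (m !) ∼ -1ℤ
    wilson-odd with j , _ , product∼1^j ← paired-product k (interval 2 k) (length-applyDownFrom _ k) (interval-unique 2 k) paired-by-1÷ = begin
      + (m !)                              ≡⟨ cong (λ r → + (m ℕ.* r)) (product-interval-2 k) ⟨
      + (m ℕ.* product (interval 2 k))     ≡⟨ ℤ.pos-* m (product (interval 2 k)) ⟩
      + m * + product (interval 2 k)       ≈⟨ *-cong-∼ m∼-1 product∼1^j ⟩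
      -1ℤ * 1ℤ ^ j                  ≡⟨ cong (-1ℤ *_) (ℤ.^-zeroˡ j) ⟩
      -1ℤ                           ∎
      where open ∼-Reasoning

  wilson : ∀ m → Prime (suc m) → ℤMod._∼_ (suc m) (+ (m !)) -1ℤ
  wilson zero          pr = ⊥-elim (¬prime[1] pr)
  wilson (suc zero)    _  = ℤMod.multiple {quotient = 1ℤ} refl
  wilson (suc (suc k)) pr = WilsonOdd.wilson-odd k pr

  module EulerCriterion (m : ℕ) (prime : Prime (suc m)) where
    open Division m prime

    module _ {c} (c≁0 : ¬ + c ∼ 0ℤ) (non-residue : ∀ y → ¬ + (y ℕ.* y) ∼ + c) where
      open PairedProduct N (c ÷_) (+ c)

      private
        module _ {x} (x∈ : x ∈ interval 1 m) where
          x<N = proj₂ (∈-interval⁻ x∈)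
          x≁0 = ≢0⇒≁0 (proj₁ (∈-interval⁻ x∈)) x<N

          c÷x∈interval : c ÷ x ∈ interval 1 m
          c÷x∈interval = ∈-interval⁺ (≁0⇒≢0 (÷-≁0 c≁0 x≁0)) (÷<N c x)

          c÷x≢x : c ÷ x ≢ x
          c÷x≢x c÷x≡x = non-residue x (subst (λ y → + (x ℕ.* y) ∼ + c) c÷x≡x (*-÷ c x≁0))

      paired-by-c÷ : Paired (interval 1 m)
      paired-by-c÷ = record
        { closed           = c÷x∈interval
        ; involutive       = λ x∈ → ÷-involutive c≁0 (x≁0 x∈) (x<N x∈)
        ; fixed-point-free = c÷x≢x
        ; pair-product     = λ x∈ → *-÷ c (x≁0 x∈) }

      euler-non-residue : ∀ {h} → m ≡ h ℕ.* 2 → (+ c) ^ h ∼ -1ℤ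
      euler-non-residue {h} m≡2h
        with j , m≡2j , product∼c^j ← paired-product m (interval 1 m) (length-applyDownFrom _ m) (interval-unique 1 m) paired-by-c÷
        rewrite ℕ.*-cancelʳ-≡ j h 2 (trans (sym m≡2j) m≡2h) = begin
          (+ c) ^ h                   ≈⟨ product∼c^j ⟨
          + product (interval 1 m)    ≡⟨ cong +_ (product-interval-1 m) ⟩
          + (m !)                 ≈⟨ wilson m prime ⟩
          -1ℤ                     ∎
        where open ∼-Reasoning

    euler-residue : ∀ {c h} → 2 < N → ¬ + c ∼ 0ℤ → m ≡ h ℕ.* 2 → (+ c) ^ h ∼ 1ℤ →
                    ∃[ s ] s < N × + (s ℕ.* s) ∼ + c
    euler-residue {c} {h} 2<N c≁0 m≡2h c^h∼1 with any? (λ (s : Fin N) → (toℕ s ℕ.* toℕ s) % N ℕ.≟ c % N)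
    ... | yes (s , s²≡c) = toℕ s , toℕ<n s , ∼-trans (∼-sym (%-∼ _)) (∼-trans (≈⇒∼ (cong +_ s²≡c)) (%-∼ c))
    ... | no ¬square = ⊥-elim (ℕ.<⇒≱ 2<N (∣⇒≤ (∼0⇒∣ 2∼0)))
      where
      non-residue : ∀ y → ¬ + (y ℕ.* y) ∼ + c
      non-residue y y²∼c = ¬square (fromℕ< (m%n<n y N) , (begin
        (toℕ (fromℕ< (m%n<n y N)) ℕ.* toℕ (fromℕ< (m%n<n y N))) % N ≡⟨ cong (λ r → (r ℕ.* r) % N) (toℕ-fromℕ< (m%n<n y N)) ⟩
        ((y % N) ℕ.* (y % N)) % N                                   ≡⟨ %-distribˡ-* y y N ⟨
        (y ℕ.* y) % N                                               ≡⟨ ∼⇒%≡ y²∼c ⟩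
        c % N                                                       ∎))
        where open ≡-Reasoning
      2∼0 : + 2 ∼ 0ℤ
      2∼0 = ∼⇒-‿∼0 (∼-trans (∼-sym c^h∼1) (euler-non-residue c≁0 non-residue {h} m≡2h))

module GroupRings where

  open import Algebra.Bundles using (CommutativeRing)
  open import Algebra.Bundles.Raw using (RawRing)
  open import Algebra.Structures using (IsCommutativeRing)
  open import Data.Fin using (#_)
  open import Data.Integer as ℤ using (ℤ; +_; 0ℤ; 1ℤ)
  import Data.Integer.Properties as ℤ
  open import Data.Integer.Tactic.RingSolver using (ring)
  open import Data.Nat using (ℕ; zero; suc)
  open import Data.Product using (_,_)
  open import Data.Vec using (Vec; _∷_; [])
  open import Level using (0ℓ)
  open import Relation.Binary.PropositionalEquality
  open Congruence using (module Modulo)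
  open IntegersModulo using (module ℤMod)
  open import Tactic.RingSolver.NonReflective ring using (module Ops; Expr; _⊕_; _⊗_; ⊝_; Ι; Κ)

  -- Instantiated at
  -- polynomial expressions, each ring law becomes a tuple of polynomial identities in the
  -- coefficients, which the ring solver's normaliser checks by evaluation.
  Poly : ℕ → Set
  Poly = Expr ℤ

  polynomials : ℕ → RawRing 0ℓ 0ℓ
  polynomials n = record
    { Carrier = Poly n ; _≈_ = _≡_ ; _+_ = _⊕_ ; _*_ = _⊗_ ; -_ = ⊝_ ; 0# = Κ 0ℤ ; 1# = Κ 1ℤ }

  ⟦_⟧ : ∀ {n} → Poly n → Vec ℤ n → ℤ
  ⟦_⟧ = Ops.⟦_⟧

  normal-forms-agree : ∀ {n} (p q : Poly n) ρ → Ops.⟦ p ⇓⟧ ρ ≡ Ops.⟦ q ⇓⟧ ρ → ⟦ p ⟧ ρ ≡ ⟦ q ⟧ ρ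
  normal-forms-agree p q ρ p≡q = trans (sym (Ops.correct p ρ)) (trans p≡q (Ops.correct q ρ))

  module ℤ[C₃] where

    record C₃ (A : Set) : Set where
      constructor ⟨_,_,_⟩
      field c₀ c₁ c₂ : A
    open C₃ public

    groupRing : RawRing 0ℓ 0ℓ → RawRing 0ℓ 0ℓ
    groupRing R = record
      { Carrier = C₃ Carrier ; _≈_ = _≡_ ; _+_ = plus ; _*_ = times ; -_ = neg
      ; 0# = ⟨ 0# , 0# , 0# ⟩ ; 1# = ⟨ 1# , 0# , 0# ⟩ }
      where
      open RawRing R
      plus times : C₃ Carrier → C₃ Carrier → C₃ Carrier
      plus ⟨ a₀ , a₁ , a₂ ⟩ ⟨ b₀ , b₁ , b₂ ⟩ = ⟨ a₀ + b₀ , a₁ + b₁ , a₂ + b₂ ⟩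
      times ⟨ a₀ , a₁ , a₂ ⟩ ⟨ b₀ , b₁ , b₂ ⟩ =
        ⟨ a₀ * b₀ + a₁ * b₂ + a₂ * b₁
        , a₀ * b₁ + a₁ * b₀ + a₂ * b₂
        , a₀ * b₂ + a₁ * b₁ + a₂ * b₀ ⟩
      neg : C₃ Carrier → C₃ Carrier
      neg ⟨ a₀ , a₁ , a₂ ⟩ = ⟨ - a₀ , - a₁ , - a₂ ⟩

    open RawRing (groupRing ℤ.+-*-rawRing) public
    private
      module P = RawRing (groupRing (polynomials 9))

      X Y Z : C₃ (Poly 9)
      X = ⟨ Ι (# 0) , Ι (# 1) , Ι (# 2) ⟩
      Y = ⟨ Ι (# 3) , Ι (# 4) , Ι (# 5) ⟩
      Z = ⟨ Ι (# 6) , Ι (# 7) , Ι (# 8) ⟩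

      ρ : C₃ ℤ → C₃ ℤ → C₃ ℤ → Vec ℤ 9
      ρ x y z = c₀ x ∷ c₁ x ∷ c₂ x ∷ c₀ y ∷ c₁ y ∷ c₂ y ∷ c₀ z ∷ c₁ z ∷ c₂ z ∷ []

      ⟦_⟧₃ : ∀ {n} → C₃ (Poly n) → Vec ℤ n → C₃ ℤ
      ⟦ p ⟧₃ ρ = ⟨ ⟦ c₀ p ⟧ ρ , ⟦ c₁ p ⟧ ρ , ⟦ c₂ p ⟧ ρ ⟩

      by-normalisation : ∀ {n} (p q : C₃ (Poly n)) ρ →
        Ops.⟦ c₀ p ⇓⟧ ρ ≡ Ops.⟦ c₀ q ⇓⟧ ρ → Ops.⟦ c₁ p ⇓⟧ ρ ≡ Ops.⟦ c₁ q ⇓⟧ ρ → Ops.⟦ c₂ p ⇓⟧ ρ ≡ Ops.⟦ c₂ q ⇓⟧ ρ →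
        ⟦ p ⟧₃ ρ ≡ ⟦ q ⟧₃ ρ
      by-normalisation p q ρ e₀ e₁ e₂ = coefficientwise
        (normal-forms-agree (c₀ p) (c₀ q) ρ e₀)
        (normal-forms-agree (c₁ p) (c₁ q) ρ e₁)
        (normal-forms-agree (c₂ p) (c₂ q) ρ e₂)
        where
        coefficientwise : ∀ {a₀ a₁ a₂ b₀ b₁ b₂ : ℤ} → a₀ ≡ b₀ → a₁ ≡ b₁ → a₂ ≡ b₂ →
                          ⟨ a₀ , a₁ , a₂ ⟩ ≡ ⟨ b₀ , b₁ , b₂ ⟩
        coefficientwise refl refl refl = refl

    isCommutativeRing : IsCommutativeRing _≡_ _+_ _*_ -_ 0# 1#
    isCommutativeRing = record
      { isRing = record
        { +-isAbelianGroup = record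
          { isGroup = record
            { isMonoid = record
              { isSemigroup = record
                { isMagma = record { isEquivalence = isEquivalence ; ∙-cong = cong₂ _+_ }
                ; assoc   = λ x y z → by-normalisation ((X P.+ Y) P.+ Z) (X P.+ (Y P.+ Z)) (ρ x y z) refl refl refl }
              ; identity = (λ x → by-normalisation (P.0# P.+ X) X (ρ x x x) refl refl refl)
                         , (λ x → by-normalisation (X P.+ P.0#) X (ρ x x x) refl refl refl) }
            ; inverse = (λ x → by-normalisation (P.- X P.+ X) P.0# (ρ x x x) refl refl refl)
                      , (λ x → by-normalisation (X P.+ P.- X) P.0# (ρ x x x) refl refl refl)
            ; ⁻¹-cong = cong -_ }
          ; comm = λ x y → by-normalisation (X P.+ Y) (Y P.+ X) (ρ x y y) refl refl refl }
        ; *-cong     = cong₂ _*_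
        ; *-assoc    = λ x y z → by-normalisation ((X P.* Y) P.* Z) (X P.* (Y P.* Z)) (ρ x y z) refl refl refl
        ; *-identity = (λ x → by-normalisation (P.1# P.* X) X (ρ x x x) refl refl refl)
                     , (λ x → by-normalisation (X P.* P.1#) X (ρ x x x) refl refl refl)
        ; distrib    = (λ x y z → by-normalisation (X P.* (Y P.+ Z)) (X P.* Y P.+ X P.* Z) (ρ x y z) refl refl refl)
                     , (λ x y z → by-normalisation ((Y P.+ Z) P.* X) (Y P.* X P.+ Z P.* X) (ρ x y z) refl refl refl) }
      ; *-comm = λ x y → by-normalisation (X P.* Y) (Y P.* X) (ρ x y y) refl refl refl }

    commutativeRing : CommutativeRing 0ℓ 0ℓ
    commutativeRing = record { isCommutativeRing = isCommutativeRing }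

    embed : ℤ → C₃ ℤ
    embed s = ⟨ s , 0ℤ , 0ℤ ⟩

    private
      module P₄ = RawRing (groupRing (polynomials 4))
      embedₚ : Poly 4 → C₃ (Poly 4)
      embedₚ e = ⟨ e , Κ 0ℤ , Κ 0ℤ ⟩

    embed-* : ∀ s t → embed s * embed t ≡ embed (s ℤ.* t)
    embed-* s t = by-normalisation (embedₚ (Ι (# 0)) P₄.* embedₚ (Ι (# 1))) (embedₚ (Ι (# 0) ⊗ Ι (# 1)))
                                   (s ∷ t ∷ 0ℤ ∷ 0ℤ ∷ []) refl refl refl

    c₁-embed-* : ∀ s x → c₁ (embed s * x) ≡ s ℤ.* c₁ x
    c₁-embed-* s x = normal-forms-agree (c₁ (embedₚ (Ι (# 0)) P₄.* ⟨ Ι (# 1) , Ι (# 2) , Ι (# 3) ⟩)) (Ι (# 0) ⊗ Ι (# 2))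
                                        (s ∷ c₀ x ∷ c₁ x ∷ c₂ x ∷ []) refl

    open import Algebra.Properties.Semiring.Exp (CommutativeRing.semiring commutativeRing) using (_^_) public
    open import Algebra.Properties.Semiring.Mult (CommutativeRing.semiring commutativeRing) using (_×_) public

    embed-^ : ∀ s n → embed s ^ n ≡ embed (s ℤ.^ n)
    embed-^ s zero    = refl
    embed-^ s (suc n) = trans (cong (embed s *_) (embed-^ s n)) (embed-* s (s ℤ.^ n))

    ×1#≡embed : ∀ n → n × 1# ≡ embed (+ n)
    ×1#≡embed zero    = refl
    ×1#≡embed (suc n) = cong (_+_ 1#) (×1#≡embed n)

    c₁-∼ : ∀ q {x y} → Modulo._∼_ commutativeRing (q × 1#) x y → ℤMod._∼_ q (c₁ x) (c₁ y)
    c₁-∼ q {x} {y} (Modulo.multiple {w} x-y≡qw) = ℤMod.multiple (begin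
      c₁ x ℤ.- c₁ y              ≡⟨ cong c₁ x-y≡qw ⟩
      c₁ ((q × 1#) * w)          ≡⟨ cong (λ e → c₁ (e * w)) (×1#≡embed q) ⟩
      c₁ (embed (+ q) * w)       ≡⟨ c₁-embed-* (+ q) w ⟩
      + q ℤ.* c₁ w               ∎)
      where open ≡-Reasoning

  module ℤ[C₅] where

    record C₅ (A : Set) : Set where
      constructor ⟨_,_,_,_,_⟩
      field c₀ c₁ c₂ c₃ c₄ : A
    open C₅ public

    groupRing : RawRing 0ℓ 0ℓ → RawRing 0ℓ 0ℓ
    groupRing R = record
      { Carrier = C₅ Carrier ; _≈_ = _≡_ ; _+_ = plus ; _*_ = times ; -_ = neg
      ; 0# = ⟨ 0# , 0# , 0# , 0# , 0# ⟩ ; 1# = ⟨ 1# , 0# , 0# , 0# , 0# ⟩ }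
      where
      open RawRing R
      plus times : C₅ Carrier → C₅ Carrier → C₅ Carrier
      plus ⟨ a₀ , a₁ , a₂ , a₃ , a₄ ⟩ ⟨ b₀ , b₁ , b₂ , b₃ , b₄ ⟩ = ⟨ a₀ + b₀ , a₁ + b₁ , a₂ + b₂ , a₃ + b₃ , a₄ + b₄ ⟩
      times ⟨ a₀ , a₁ , a₂ , a₃ , a₄ ⟩ ⟨ b₀ , b₁ , b₂ , b₃ , b₄ ⟩ =
        ⟨ a₀ * b₀ + a₁ * b₄ + a₂ * b₃ + a₃ * b₂ + a₄ * b₁
        , a₀ * b₁ + a₁ * b₀ + a₂ * b₄ + a₃ * b₃ + a₄ * b₂
        , a₀ * b₂ + a₁ * b₁ + a₂ * b₀ + a₃ * b₄ + a₄ * b₃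
        , a₀ * b₃ + a₁ * b₂ + a₂ * b₁ + a₃ * b₀ + a₄ * b₄
        , a₀ * b₄ + a₁ * b₃ + a₂ * b₂ + a₃ * b₁ + a₄ * b₀ ⟩
      neg : C₅ Carrier → C₅ Carrier
      neg ⟨ a₀ , a₁ , a₂ , a₃ , a₄ ⟩ = ⟨ - a₀ , - a₁ , - a₂ , - a₃ , - a₄ ⟩

    open RawRing (groupRing ℤ.+-*-rawRing) public
    private
      module P = RawRing (groupRing (polynomials 15))

      X Y Z : C₅ (Poly 15)
      X = ⟨ Ι (# 0) , Ι (# 1) , Ι (# 2) , Ι (# 3) , Ι (# 4) ⟩
      Y = ⟨ Ι (# 5) , Ι (# 6) , Ι (# 7) , Ι (# 8) , Ι (# 9) ⟩
      Z = ⟨ Ι (# 10) , Ι (# 11) , Ι (# 12) , Ι (# 13) , Ι (# 14) ⟩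

      ρ : C₅ ℤ → C₅ ℤ → C₅ ℤ → Vec ℤ 15
      ρ x y z = c₀ x ∷ c₁ x ∷ c₂ x ∷ c₃ x ∷ c₄ x ∷ c₀ y ∷ c₁ y ∷ c₂ y ∷ c₃ y ∷ c₄ y ∷ c₀ z ∷ c₁ z ∷ c₂ z ∷ c₃ z ∷ c₄ z ∷ []

      ⟦_⟧₅ : ∀ {n} → C₅ (Poly n) → Vec ℤ n → C₅ ℤ
      ⟦ p ⟧₅ ρ = ⟨ ⟦ c₀ p ⟧ ρ , ⟦ c₁ p ⟧ ρ , ⟦ c₂ p ⟧ ρ , ⟦ c₃ p ⟧ ρ , ⟦ c₄ p ⟧ ρ ⟩

      by-normalisation : ∀ {n} (p q : C₅ (Poly n)) ρ →
        Ops.⟦ c₀ p ⇓⟧ ρ ≡ Ops.⟦ c₀ q ⇓⟧ ρ → Ops.⟦ c₁ p ⇓⟧ ρ ≡ Ops.⟦ c₁ q ⇓⟧ ρ → Ops.⟦ c₂ p ⇓⟧ ρ ≡ Ops.⟦ c₂ q ⇓⟧ ρ → Ops.⟦ c₃ p ⇓⟧ ρ ≡ Ops.⟦ c₃ q ⇓⟧ ρ → Ops.⟦ c₄ p ⇓⟧ ρ ≡ Ops.⟦ c₄ q ⇓⟧ ρ →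
        ⟦ p ⟧₅ ρ ≡ ⟦ q ⟧₅ ρ
      by-normalisation p q ρ e₀ e₁ e₂ e₃ e₄ = coefficientwise
        (normal-forms-agree (c₀ p) (c₀ q) ρ e₀)
        (normal-forms-agree (c₁ p) (c₁ q) ρ e₁)
        (normal-forms-agree (c₂ p) (c₂ q) ρ e₂)
        (normal-forms-agree (c₃ p) (c₃ q) ρ e₃)
        (normal-forms-agree (c₄ p) (c₄ q) ρ e₄)
        where
        coefficientwise : ∀ {a₀ a₁ a₂ a₃ a₄ b₀ b₁ b₂ b₃ b₄ : ℤ} → a₀ ≡ b₀ → a₁ ≡ b₁ → a₂ ≡ b₂ → a₃ ≡ b₃ → a₄ ≡ b₄ →
                          ⟨ a₀ , a₁ , a₂ , a₃ , a₄ ⟩ ≡ ⟨ b₀ , b₁ , b₂ , b₃ , b₄ ⟩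
        coefficientwise refl refl refl refl refl = refl

    isCommutativeRing : IsCommutativeRing _≡_ _+_ _*_ -_ 0# 1#
    isCommutativeRing = record
      { isRing = record
        { +-isAbelianGroup = record
          { isGroup = record
            { isMonoid = record
              { isSemigroup = record
                { isMagma = record { isEquivalence = isEquivalence ; ∙-cong = cong₂ _+_ }
                ; assoc   = λ x y z → by-normalisation ((X P.+ Y) P.+ Z) (X P.+ (Y P.+ Z)) (ρ x y z) refl refl refl refl refl }
              ; identity = (λ x → by-normalisation (P.0# P.+ X) X (ρ x x x) refl refl refl refl refl)
                         , (λ x → by-normalisation (X P.+ P.0#) X (ρ x x x) refl refl refl refl refl) }
            ; inverse = (λ x → by-normalisation (P.- X P.+ X) P.0# (ρ x x x) refl refl refl refl refl)
                      , (λ x → by-normalisation (X P.+ P.- X) P.0# (ρ x x x) refl refl refl refl refl)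
            ; ⁻¹-cong = cong -_ }
          ; comm = λ x y → by-normalisation (X P.+ Y) (Y P.+ X) (ρ x y y) refl refl refl refl refl }
        ; *-cong     = cong₂ _*_
        ; *-assoc    = λ x y z → by-normalisation ((X P.* Y) P.* Z) (X P.* (Y P.* Z)) (ρ x y z) refl refl refl refl refl
        ; *-identity = (λ x → by-normalisation (P.1# P.* X) X (ρ x x x) refl refl refl refl refl)
                     , (λ x → by-normalisation (X P.* P.1#) X (ρ x x x) refl refl refl refl refl)
        ; distrib    = (λ x y z → by-normalisation (X P.* (Y P.+ Z)) (X P.* Y P.+ X P.* Z) (ρ x y z) refl refl refl refl refl)
                     , (λ x y z → by-normalisation ((Y P.+ Z) P.* X) (Y P.* X P.+ Z P.* X) (ρ x y z) refl refl refl refl refl) }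
      ; *-comm = λ x y → by-normalisation (X P.* Y) (Y P.* X) (ρ x y y) refl refl refl refl refl }

    commutativeRing : CommutativeRing 0ℓ 0ℓ
    commutativeRing = record { isCommutativeRing = isCommutativeRing }

    embed : ℤ → C₅ ℤ
    embed s = ⟨ s , 0ℤ , 0ℤ , 0ℤ , 0ℤ ⟩

    private
      module P₆ = RawRing (groupRing (polynomials 6))
      embedₚ : Poly 6 → C₅ (Poly 6)
      embedₚ e = ⟨ e , Κ 0ℤ , Κ 0ℤ , Κ 0ℤ , Κ 0ℤ ⟩

    embed-* : ∀ s t → embed s * embed t ≡ embed (s ℤ.* t)
    embed-* s t = by-normalisation (embedₚ (Ι (# 0)) P₆.* embedₚ (Ι (# 1))) (embedₚ (Ι (# 0) ⊗ Ι (# 1)))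
                                   (s ∷ t ∷ 0ℤ ∷ 0ℤ ∷ 0ℤ ∷ 0ℤ ∷ []) refl refl refl refl refl

    c₁-embed-* : ∀ s x → c₁ (embed s * x) ≡ s ℤ.* c₁ x
    c₁-embed-* s x = normal-forms-agree (c₁ (embedₚ (Ι (# 0)) P₆.* ⟨ Ι (# 1) , Ι (# 2) , Ι (# 3) , Ι (# 4) , Ι (# 5) ⟩)) (Ι (# 0) ⊗ Ι (# 2))
                                        (s ∷ c₀ x ∷ c₁ x ∷ c₂ x ∷ c₃ x ∷ c₄ x ∷ []) refl

    open import Algebra.Properties.Semiring.Exp (CommutativeRing.semiring commutativeRing) using (_^_) public
    open import Algebra.Properties.Semiring.Mult (CommutativeRing.semiring commutativeRing) using (_×_) public

    embed-^ : ∀ s n → embed s ^ n ≡ embed (s ℤ.^ n)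
    embed-^ s zero    = refl
    embed-^ s (suc n) = trans (cong (embed s *_) (embed-^ s n)) (embed-* s (s ℤ.^ n))

    ×1#≡embed : ∀ n → n × 1# ≡ embed (+ n)
    ×1#≡embed zero    = refl
    ×1#≡embed (suc n) = cong (_+_ 1#) (×1#≡embed n)

    c₁-∼ : ∀ q {x y} → Modulo._∼_ commutativeRing (q × 1#) x y → ℤMod._∼_ q (c₁ x) (c₁ y)
    c₁-∼ q {x} {y} (Modulo.multiple {w} x-y≡qw) = ℤMod.multiple (begin
      c₁ x ℤ.- c₁ y              ≡⟨ cong c₁ x-y≡qw ⟩
      c₁ ((q × 1#) * w)          ≡⟨ cong (λ e → c₁ (e * w)) (×1#≡embed q) ⟩
      c₁ (embed (+ q) * w)       ≡⟨ c₁-embed-* (+ q) w ⟩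
      + q ℤ.* c₁ w               ∎)
      where open ≡-Reasoning

module GaussSums where

  open import Algebra.Bundles using (CommutativeRing)
  open import Data.Integer as ℤ using (ℤ; +_; 0ℤ; 1ℤ; -1ℤ)
  import Data.Integer.Properties as ℤ
  open import Data.Nat as ℕ using (ℕ; zero; suc)
  open import Data.Nat.Primality using (Prime)
  open import Data.Nat.Tactic.RingSolver using (solve-∀)
  open import Level using (0ℓ)
  open import Relation.Binary.PropositionalEquality as ≡ using (_≡_)
  open Congruence
  open Frobenius
  open IntegersModulo using (module ℤMod)
  open GroupRings

  module GaussSum (R : CommutativeRing 0ℓ 0ℓ) (m : ℕ) (prime : Prime (suc m)) (h : ℕ) (m≡2h : m ≡ h ℕ.* 2) where
    open CommutativeRing R
    open import Algebra.Properties.Ring ring using (-‿distribˡ-*; -‿distribʳ-*; -‿involutive)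
    open import Algebra.Properties.Semiring.Exp semiring using (_^_; ^-homo-*; ^-assocʳ)
    open import Algebra.Properties.Semiring.Mult semiring using (_×_)
    open import Relation.Binary.Reasoning.Setoid setoid

    q : ℕ
    q = suc m

    open Modulo R (q × 1#) public

    private
      -x*-x≈x*x : ∀ x → - x * - x ≈ x * x
      -x*-x≈x*x x = begin
        - x * - x      ≈⟨ -‿distribˡ-* x (- x) ⟨
        - (x * - x)    ≈⟨ -‿cong (-‿distribʳ-* x x) ⟨
        - - (x * x)    ≈⟨ -‿involutive (x * x) ⟩
        x * x          ∎

      -‿^-even : ∀ x k → (- x) ^ (k ℕ.* 2) ≈ x ^ (k ℕ.* 2)
      -‿^-even x zero    = refl
      -‿^-even x (suc k) = begin
        - x * (- x * (- x) ^ (k ℕ.* 2))  ≈⟨ *-assoc (- x) (- x) _ ⟨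
        (- x * - x) * (- x) ^ (k ℕ.* 2)  ≈⟨ *-cong (-x*-x≈x*x x) (-‿^-even x k) ⟩
        (x * x) * x ^ (k ℕ.* 2)          ≈⟨ *-assoc x x _ ⟩
        x * (x * x ^ (k ℕ.* 2))          ∎

    -‿^q : ∀ x → (- x) ^ q ≈ - (x ^ q)
    -‿^q x rewrite m≡2h = begin
      - x * (- x) ^ (h ℕ.* 2)  ≈⟨ *-congˡ (-‿^-even x h) ⟩
      - x * x ^ (h ℕ.* 2)      ≈⟨ -‿distribˡ-* x _ ⟨
      - (x * x ^ (h ℕ.* 2))    ∎

    root-of-unity-^q : ∀ {ζ n} → ζ ^ n ≈ 1# → ∀ t {r} → q ≡ t ℕ.* n ℕ.+ r → ∀ k → (ζ ^ k) ^ q ≈ ζ ^ (k ℕ.* r)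
    root-of-unity-^q {ζ} {n} ζⁿ≈1 t {r} q≡tn+r k = begin
      (ζ ^ k) ^ q                        ≈⟨ ^-assocʳ ζ k q ⟩
      ζ ^ (k ℕ.* q)                      ≡⟨ ≡.cong (λ e → ζ ^ (k ℕ.* e)) q≡tn+r ⟩
      ζ ^ (k ℕ.* (t ℕ.* n ℕ.+ r))        ≡⟨ ≡.cong (ζ ^_) (distribute k t n r) ⟩
      ζ ^ (k ℕ.* t ℕ.* n ℕ.+ k ℕ.* r)    ≈⟨ ^-homo-* ζ (k ℕ.* t ℕ.* n) (k ℕ.* r) ⟩
      ζ ^ (k ℕ.* t ℕ.* n) * ζ ^ (k ℕ.* r) ≈⟨ *-congʳ (ζ^an≈1 (k ℕ.* t)) ⟩
      1# * ζ ^ (k ℕ.* r)                 ≈⟨ *-identityˡ (ζ ^ (k ℕ.* r)) ⟩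
      ζ ^ (k ℕ.* r)                      ∎
      where
      distribute : ∀ k t n r → k ℕ.* (t ℕ.* n ℕ.+ r) ≡ k ℕ.* t ℕ.* n ℕ.+ k ℕ.* r
      distribute = solve-∀
      ζ^an≈1 : ∀ a → ζ ^ (a ℕ.* n) ≈ 1#
      ζ^an≈1 zero    = refl
      ζ^an≈1 (suc a) = begin
        ζ ^ (n ℕ.+ a ℕ.* n)       ≈⟨ ^-homo-* ζ n (a ℕ.* n) ⟩
        ζ ^ n * ζ ^ (a ℕ.* n)     ≈⟨ *-cong ζⁿ≈1 (ζ^an≈1 a) ⟩
        1# * 1#                   ≈⟨ *-identityˡ 1# ⟩
        1#                        ∎

    gauss-sum : ∀ {τ d} → τ * τ * τ ≈ d * τ → τ ^ q ∼ - τ → d ^ h * τ ∼ - τ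
    gauss-sum {τ} {d} τ³≈dτ τ^q∼-τ = ∼-trans (≈⇒∼ (sym (τ^odd h))) (≡.subst (λ n → τ ^ n ∼ - τ) (≡.cong suc m≡2h) τ^q∼-τ)
      where
      τ^odd : ∀ k → τ ^ suc (k ℕ.* 2) ≈ d ^ k * τ
      τ^odd zero    = trans (*-identityʳ τ) (sym (*-identityˡ τ))
      τ^odd (suc k) = begin
        τ * (τ * τ ^ suc (k ℕ.* 2))  ≈⟨ *-congˡ (*-congˡ (τ^odd k)) ⟩
        τ * (τ * (d ^ k * τ))        ≈⟨ *-congˡ (x∙yz≈y∙xz τ (d ^ k) τ) ⟩
        τ * (d ^ k * (τ * τ))        ≈⟨ x∙yz≈y∙xz τ (d ^ k) (τ * τ) ⟩
        d ^ k * (τ * (τ * τ))        ≈⟨ *-congˡ (*-assoc τ τ τ) ⟨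
        d ^ k * (τ * τ * τ)          ≈⟨ *-congˡ τ³≈dτ ⟩
        d ^ k * (d * τ)              ≈⟨ x∙yz≈y∙xz (d ^ k) d τ ⟩
        d * (d ^ k * τ)              ≈⟨ *-assoc d (d ^ k) τ ⟨
        d * d ^ k * τ                ∎
        where open import Algebra.Properties.CommutativeSemigroup *-commutativeSemigroup using (x∙yz≈y∙xz)

  module GaussSum₃ (m : ℕ) (prime : Prime (suc m)) (h : ℕ) (m≡2h : m ≡ h ℕ.* 2) (t : ℕ) (q≡3t+2 : suc m ≡ t ℕ.* 3 ℕ.+ 2) where
    open ℤ[C₃]
    open GaussSum commutativeRing m prime h m≡2h
    open CommutativeRing commutativeRing using (_-_)

    ζ : C₃ ℤ
    ζ = ⟨ 0ℤ , 1ℤ , 0ℤ ⟩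

    ζ³≡1 : ζ ^ 3 ≡ 1#
    ζ³≡1 = ≡.refl

    τ : C₃ ℤ
    τ = ζ - ζ ^ 2

    τ^q∼-τ : τ ^ q ∼ - τ
    τ^q∼-τ = begin
      (ζ - ζ ^ 2) ^ q            ≈⟨ frobenius commutativeRing prime ζ (- ζ ^ 2) ⟩
      (ζ ^ 1) ^ q + (- ζ ^ 2) ^ q ≈⟨ ≈⇒∼ (≡.cong₂ _+_ (ζ^k^q 1) (≡.trans (-‿^q (ζ ^ 2)) (≡.cong -_ (ζ^k^q 2)))) ⟩
      ζ ^ 2 - ζ ^ 4              ≡⟨ ≡.refl ⟩
      - τ                        ∎
      where
      open ∼-Reasoning
      ζ^k^q : ∀ k → (ζ ^ k) ^ q ≡ ζ ^ (k ℕ.* 2)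
      ζ^k^q = root-of-unity-^q {n = 3} ζ³≡1 t q≡3t+2

    -- In ℤ[C₃] (rather than ℤ[ζ₃]) τ² = -3 + (1 + ζ + ζ²), and 1 + ζ + ζ² annihilates τ.
    τ³≡[-3]τ : τ * τ * τ ≡ embed (ℤ.- + 3) * τ
    τ³≡[-3]τ = ≡.refl

    [-3]^h∼-1 : ℤMod._∼_ q ((ℤ.- + 3) ℤ.^ h) -1ℤ
    [-3]^h∼-1 = ≡.subst (λ a → ℤMod._∼_ q a -1ℤ) c₁-lhs (c₁-∼ q (gauss-sum τ³≡[-3]τ τ^q∼-τ))
      where
      c₁-lhs : c₁ (embed (ℤ.- + 3) ^ h * τ) ≡ (ℤ.- + 3) ℤ.^ h
      c₁-lhs = ≡.trans (≡.cong (λ e → c₁ (e * τ)) (embed-^ (ℤ.- + 3) h))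
                      (≡.trans (c₁-embed-* ((ℤ.- + 3) ℤ.^ h) τ) (ℤ.*-identityʳ ((ℤ.- + 3) ℤ.^ h)))

  module GaussSum₅ (m : ℕ) (prime : Prime (suc m)) (h : ℕ) (m≡2h : m ≡ h ℕ.* 2) (t : ℕ) (q≡5t+2 : suc m ≡ t ℕ.* 5 ℕ.+ 2) where
    open ℤ[C₅]
    open GaussSum commutativeRing m prime h m≡2h
    open CommutativeRing commutativeRing using (_-_)

    ζ : C₅ ℤ
    ζ = ⟨ 0ℤ , 1ℤ , 0ℤ , 0ℤ , 0ℤ ⟩

    ζ⁵≡1 : ζ ^ 5 ≡ 1#
    ζ⁵≡1 = ≡.refl

    τ : C₅ ℤ
    τ = ζ - ζ ^ 2 - ζ ^ 3 + ζ ^ 4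

    τ^q∼-τ : τ ^ q ∼ - τ
    τ^q∼-τ = begin
      (ζ - ζ ^ 2 - ζ ^ 3 + ζ ^ 4) ^ q
        ≈⟨ ∼-trans (frobenius commutativeRing prime (ζ - ζ ^ 2 - ζ ^ 3) (ζ ^ 4))
             (+-cong-∼ (∼-trans (frobenius commutativeRing prime (ζ - ζ ^ 2) (- ζ ^ 3))
                          (+-cong-∼ (frobenius commutativeRing prime ζ (- ζ ^ 2)) ∼-refl)) ∼-refl) ⟩
      (ζ ^ 1) ^ q + (- ζ ^ 2) ^ q + (- ζ ^ 3) ^ q + (ζ ^ 4) ^ q
        ≈⟨ ≈⇒∼ (≡.cong₂ _+_ (≡.cong₂ _+_ (≡.cong₂ _+_ (ζ^k^q 1) (-ζ^k^q 2)) (-ζ^k^q 3)) (ζ^k^q 4)) ⟩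
      ζ ^ 2 - ζ ^ 4 - ζ ^ 6 + ζ ^ 8
        ≡⟨ ≡.refl ⟩
      - τ ∎
      where
      open ∼-Reasoning
      ζ^k^q : ∀ k → (ζ ^ k) ^ q ≡ ζ ^ (k ℕ.* 2)
      ζ^k^q = root-of-unity-^q {n = 5} ζ⁵≡1 t q≡5t+2
      -ζ^k^q : ∀ k → (- ζ ^ k) ^ q ≡ - ζ ^ (k ℕ.* 2)
      -ζ^k^q k = ≡.trans (-‿^q (ζ ^ k)) (≡.cong -_ (ζ^k^q k))

    τ³≡5τ : τ * τ * τ ≡ embed (+ 5) * τ
    τ³≡5τ = ≡.refl

    5^h∼-1 : ℤMod._∼_ q ((+ 5) ℤ.^ h) -1ℤ
    5^h∼-1 = ≡.subst (λ a → ℤMod._∼_ q a -1ℤ) c₁-lhs (c₁-∼ q (gauss-sum τ³≡5τ τ^q∼-τ))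
      where
      c₁-lhs : c₁ (embed (+ 5) ^ h * τ) ≡ (+ 5) ℤ.^ h
      c₁-lhs = ≡.trans (≡.cong (λ e → c₁ (e * τ)) (embed-^ (+ 5) h))
                      (≡.trans (c₁-embed-* ((+ 5) ℤ.^ h) τ) (ℤ.*-identityʳ ((+ 5) ℤ.^ h)))

module QuadraticCharacterOfTwo where

  open import Data.Integer as ℤ using (ℤ; +_; _+_; _*_; _-_; _^_; 0ℤ; 1ℤ; -1ℤ)
  import Data.Integer.Properties as ℤ
  open import Data.Integer.Tactic.RingSolver using (solve-∀)
  open import Data.Nat.Tactic.RingSolver using () renaming (solve-∀ to ℕ-solve-∀)
  open import Data.Nat as ℕ using (ℕ; suc; _<_)
  open import Data.Nat.Divisibility using (∣⇒≤)
  open import Data.Nat.Primality using (Prime)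
  import Data.Nat.Properties as ℕ
  open import Relation.Binary.PropositionalEquality
  open import Relation.Nullary using (¬_)
  open IntegersModulo using (^-distribʳ-*)
  open Euler using (module Division)

  module _ (m : ℕ) (prime : Prime (suc m)) where
    open Division m prime

    2^[k*4]∼1 : ∀ i k → m ≡ i ℕ.* i → m ≡ k ℕ.* 4 ℕ.* 2 → 2 < N → (+ 2) ^ (k ℕ.* 4) ∼ 1ℤ
    2^[k*4]∼1 i k m≡i² m≡8k 2<N = begin
      (+ 2) ^ (k ℕ.* 4)                       ≡⟨ ℤ.*-identityʳ _ ⟨
      (+ 2) ^ (k ℕ.* 4) * 1ℤ                  ≈⟨ *-congˡ-∼ ((+ 2) ^ (k ℕ.* 4)) i^[k*4]∼1 ⟨
      (+ 2) ^ (k ℕ.* 4) * (+ i) ^ (k ℕ.* 4)   ≡⟨ ^-distribʳ-* (+ 2) (+ i) (k ℕ.* 4) ⟨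
      (+ 2 * + i) ^ (k ℕ.* 4)                 ≈⟨ ^-cong-∼ (k ℕ.* 4) [1+i]²∼2i ⟨
      ((1ℤ + + i) ^ 2) ^ (k ℕ.* 4)            ≡⟨ trans (ℤ.^-*-assoc (1ℤ + + i) 2 (k ℕ.* 4)) (cong ((1ℤ + + i) ^_) (sym (trans m≡8k (ℕ.*-comm (k ℕ.* 4) 2)))) ⟩
      (1ℤ + + i) ^ m                          ≈⟨ fermat-^m 1+i≁0 ⟩
      1ℤ                                      ∎
      where
      open ∼-Reasoning
      i²∼-1 : + i * + i ∼ -1ℤ
      i²∼-1 = subst (_∼ -1ℤ) (trans (cong +_ m≡i²) (ℤ.pos-* i i)) m∼-1
      [1+i]²∼2i : (1ℤ + + i) ^ 2 ∼ + 2 * + i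
      [1+i]²∼2i = begin
        (1ℤ + + i) ^ 2                ≡⟨ square-of-sum (+ i) ⟩
        + 2 * + i + (1ℤ + + i * + i)  ≈⟨ +-congˡ-∼ (+ 2 * + i) (+-congˡ-∼ 1ℤ i²∼-1) ⟩
        + 2 * + i + (1ℤ + -1ℤ)        ≡⟨ ℤ.+-identityʳ (+ 2 * + i) ⟩
        + 2 * + i                     ∎
        where
        square-of-sum : ∀ x → (1ℤ + x) * ((1ℤ + x) * 1ℤ) ≡ + 2 * x + (1ℤ + x * x)
        square-of-sum = solve-∀
      k*4≡2*2k : ∀ k → k ℕ.* 4 ≡ 2 ℕ.* (k ℕ.* 2)
      k*4≡2*2k = ℕ-solve-∀
      i^[k*4]∼1 : (+ i) ^ (k ℕ.* 4) ∼ 1ℤ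
      i^[k*4]∼1 = begin
        (+ i) ^ (k ℕ.* 4)        ≡⟨ trans (ℤ.^-*-assoc (+ i) 2 (k ℕ.* 2)) (cong ((+ i) ^_) (sym (k*4≡2*2k k))) ⟨
        ((+ i) ^ 2) ^ (k ℕ.* 2)  ≈⟨ ^-cong-∼ (k ℕ.* 2) (subst (_∼ -1ℤ) (cong (+ i *_) (sym (ℤ.*-identityʳ (+ i)))) i²∼-1) ⟩
        -1ℤ ^ (k ℕ.* 2)          ≡⟨ trans (cong (-1ℤ ^_) (ℕ.*-comm k 2)) (trans (sym (ℤ.^-*-assoc -1ℤ 2 k)) (ℤ.^-zeroˡ k)) ⟩
        1ℤ                       ∎
      1+i≁0 : ¬ (1ℤ + + i) ∼ 0ℤ
      1+i≁0 1+i∼0 = ℕ.<⇒≱ 2<N (∣⇒≤ (∼0⇒∣ (∼⇒-‿∼0 1∼-1)))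
        where
        i∼-1 : + i ∼ -1ℤ
        i∼-1 = -‿∼0⇒∼ (subst (_∼ 0ℤ) (ℤ.+-comm 1ℤ (+ i)) 1+i∼0)
        1∼-1 : 1ℤ ∼ -1ℤ
        1∼-1 = ∼-trans (*-cong-∼ (∼-sym i∼-1) (∼-sym i∼-1)) i²∼-1

module Arithmetic where

  open import Data.Nat
  open import Data.Nat.DivMod
  open import Data.Nat.Divisibility using (divides)
  open import Data.Nat.Primality using (Prime; prime⇒irreducible)
  open import Data.Nat.Properties
  open import Data.Nat.Tactic.RingSolver using (solve-∀)
  open import Data.Sum using (_⊎_; inj₁; inj₂; [_,_]′)
  open import Relation.Binary.PropositionalEquality
  open import Relation.Nullary using (contradiction)

  %-distribˡ-^ : ∀ a k d .{{_ : NonZero d}} → (a ^ k) % d ≡ ((a % d) ^ k) % d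
  %-distribˡ-^ a zero    d = refl
  %-distribˡ-^ a (suc k) d = begin
    (a * a ^ k) % d                              ≡⟨ %-distribˡ-* a (a ^ k) d ⟩
    ((a % d) * ((a ^ k) % d)) % d                ≡⟨ cong (λ r → ((a % d) * r) % d) (%-distribˡ-^ a k d) ⟩
    ((a % d) * (((a % d) ^ k) % d)) % d          ≡⟨ cong (λ r → (r * (((a % d) ^ k) % d)) % d) (m%n%n≡m%n a d) ⟨
    ((a % d % d) * (((a % d) ^ k) % d)) % d      ≡⟨ %-distribˡ-* (a % d) ((a % d) ^ k) d ⟨
    ((a % d) * (a % d) ^ k) % d                  ∎
    where open ≡-Reasoning

  1+ab≡2-mod : ∀ a b d .{{_ : NonZero d}} → a % d ≡ 1 → b % d ≡ 1 → suc (a * b) ≡ suc (a * b) / d * d + 2 % d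
  1+ab≡2-mod a b d a≡1 b≡1 = trans (m≡m%n+[m/n]*n (suc (a * b)) d) (trans (cong (_+ suc (a * b) / d * d) 1+ab%d≡2%d) (+-comm (2 % d) _))
    where
    open ≡-Reasoning
    1+ab%d≡2%d : suc (a * b) % d ≡ 2 % d
    1+ab%d≡2%d = begin
      (1 + a * b) % d                      ≡⟨ %-distribˡ-+ 1 (a * b) d ⟩
      (1 % d + (a * b) % d) % d            ≡⟨ cong (λ r → (1 % d + r) % d) (%-distribˡ-* a b d) ⟩
      (1 % d + (a % d) * (b % d) % d) % d  ≡⟨ cong₂ (λ u v → (1 % d + (u * v) % d) % d) a≡1 b≡1 ⟩
      (1 % d + (1 * 1) % d) % d            ≡⟨ %-distribˡ-+ 1 1 d ⟨
      2 % d                                ∎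

  a^n≡1-mod : ∀ a n d .{{_ : NonZero d}} → a % d ≡ 1 % d → (a ^ n) % d ≡ 1 % d
  a^n≡1-mod a n d a≡1 = begin
    (a ^ n) % d          ≡⟨ %-distribˡ-^ a n d ⟩
    ((a % d) ^ n) % d    ≡⟨ cong (λ r → (r ^ n) % d) a≡1 ⟩
    ((1 % d) ^ n) % d    ≡⟨ %-distribˡ-^ 1 n d ⟨
    (1 ^ n) % d          ≡⟨ cong (_% d) (^-zeroˡ n) ⟩
    1 % d                ∎
    where open ≡-Reasoning

  module _ {p : ℕ} (p-prime : Prime p) (p≡±1 : p % 10 ≡ 1 ⊎ p % 10 ≡ 9) where

    private
      p≢3 : p ≢ 3
      p≢3 p≡3 = [ (λ ()) , (λ ()) ]′ (subst (λ r → r % 10 ≡ 1 ⊎ r % 10 ≡ 9) p≡3 p≡±1)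

      p%3≡±1 : p % 3 ≡ 1 ⊎ p % 3 ≡ 2
      p%3≡±1 with p % 3 in eq | m%n<n p 3
      ... | 0 | _ with prime⇒irreducible p-prime (divides (p / 3) (trans (m≡m%n+[m/n]*n p 3) (cong (_+ p / 3 * 3) eq)))
      ...   | inj₂ 3≡p = contradiction (sym 3≡p) p≢3
      p%3≡±1 | 1 | _ = inj₁ refl
      p%3≡±1 | 2 | _ = inj₂ refl
      p%3≡±1 | suc (suc (suc _)) | s≤s (s≤s (s≤s ()))

      p%5≡±1 : p % 5 ≡ 1 ⊎ p % 5 ≡ 4
      p%5≡±1 = [ (λ e → inj₁ (trans p%5≡p%10%5 (cong (_% 5) e))) , (λ e → inj₂ (trans p%5≡p%10%5 (cong (_% 5) e))) ]′ p≡±1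
        where
        p%5≡p%10%5 : p % 5 ≡ p % 10 % 5
        p%5≡p%10%5 = sym (m∣n⇒o%n%m≡o%m 5 10 p (divides 2 refl))

    p²≡1-mod3 : (p ^ 2) % 3 ≡ 1
    p²≡1-mod3 = trans (%-distribˡ-^ p 2 3) ([ (λ e → cong (λ r → (r ^ 2) % 3) e) , (λ e → cong (λ r → (r ^ 2) % 3) e) ]′ p%3≡±1)

    p²≡1-mod5 : (p ^ 2) % 5 ≡ 1
    p²≡1-mod5 = trans (%-distribˡ-^ p 2 5) ([ (λ e → cong (λ r → (r ^ 2) % 5) e) , (λ e → cong (λ r → (r ^ 2) % 5) e) ]′ p%5≡±1)

  16^n≡4^n*4^n : ∀ n → 16 ^ n ≡ 4 ^ n * 4 ^ n
  16^n≡4^n*4^n zero    = refl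
  16^n≡4^n*4^n (suc n) = trans (cong (16 *_) (16^n≡4^n*4^n n)) (regroup (4 ^ n) (4 ^ n))
    where
    regroup : ∀ x y → 16 * (x * y) ≡ 4 * x * (4 * y)
    regroup = solve-∀

module QuadraticTwist where

  open import Data.Bool using (Bool; true; false; if_then_else_)
  open import Data.Empty using (⊥-elim)
  open import Data.Integer as ℤ using (ℤ; +_; -_; _+_; _*_; _-_; _^_; 0ℤ; 1ℤ)
  import Data.Integer.Properties as ℤ
  open import Data.Integer.Tactic.RingSolver using (solve-∀)
  open import Data.Nat as ℕ using (ℕ; zero; suc; _<_; _≤_; _∸_; _≡ᵇ_)
  open import Data.Nat.DivMod using (m%n<n; m<n⇒m%n≡m)
  open import Data.Nat.Primality using (Prime)
  import Data.Nat.Properties as ℕ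
  open import Data.Product using (_,_)
  open import Data.Sum using (inj₁; inj₂)
  open import Relation.Binary.PropositionalEquality
  open import Relation.Nullary using (¬_)
  open import Defs
  open IntegersModulo using (pos-^; ^-distribʳ-*)
  open Euler using (module Division)

  -- Writing q = 2 + k makes q ∸ 1 and q ∸ 2 in Fq compute, so that red, neg and inv unfold.
  module Twist (k : ℕ) (prime : Prime (2 ℕ.+ k)) where
    open Division (suc k) prime
    open Fq N using (red; neg; inv)

    red-∼ : ∀ x → + red x ∼ + x
    red-∼ = %-∼

    red<N : ∀ x → red x < N
    red<N x = m%n<n x N

    red-reduced : ∀ {x} → x < N → red x ≡ x
    red-reduced = m<n⇒m%n≡m

    neg-∼ : ∀ {x} → x ≤ N → + neg x ∼ - + x
    neg-∼ {x} x≤N = ∼-trans (red-∼ (N ∸ x)) (∸-∼ x≤N)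

    inv-∼ : ∀ x → + inv x ∼ (+ x) ^ k
    inv-∼ x = ∼-trans (red-∼ (x ℕ.^ k)) (≈⇒∼ (pos-^ x k))

    module _ {a b c s : ℕ} (s≁0 : ¬ + s ∼ 0ℤ) (s²∼b : + (s ℕ.* s) ∼ + b) where
      private
        E₁ Eb : Curve
        E₁ = curve 1 a c
        Eb = curve b a c

      scale : Pt → Pt
      scale ∞ = ∞
      scale (af x y) = af x (red (s ℕ.* y))

      s⁻¹ : ℕ
      s⁻¹ = 1 ÷ s

      s⁻¹*s∼1 : + s⁻¹ * + s ∼ 1ℤ
      s⁻¹*s∼1 = subst (_∼ 1ℤ) (trans (cong +_ (ℕ.*-comm s s⁻¹)) (ℤ.pos-* s⁻¹ s)) (*-÷ 1 s≁0)

      unscale : Pt → Pt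
      unscale ∞ = ∞
      unscale (af x y) = af x (red (s⁻¹ ℕ.* y))

      private
        ι* : ∀ m n → + (m ℕ.* n) ∼ + m * + n
        ι* m n = ≈⇒∼ (ℤ.pos-* m n)

        ι+ : ∀ m n → + (m ℕ.+ n) ∼ + m + + n
        ι+ m n = ≈⇒∼ (ℤ.pos-+ m n)

        ι** : ∀ l m n → + (l ℕ.* m ℕ.* n) ∼ + l * + m * + n
        ι** l m n = ∼-trans (ι* (l ℕ.* m) n) (*-congʳ-∼ (+ n) (ι* l m))

        ι+-congʳ : ∀ {u v} w → + u ∼ + v → + (u ℕ.+ w) ∼ + (v ℕ.+ w)
        ι+-congʳ {u} {v} w u∼v = ∼-trans (ι+ u w) (∼-trans (+-congʳ-∼ (+ w) u∼v) (∼-sym (ι+ v w)))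

        red-s* : ∀ y → + red (s ℕ.* y) ∼ + s * + y
        red-s* y = ∼-trans (red-∼ (s ℕ.* y)) (ι* s y)

        b∼s*s : + b ∼ + s * + s
        b∼s*s = ∼-trans (∼-sym s²∼b) (ι* s s)

      scale-on : ∀ P → OnCurve N Eb P → OnCurve N E₁ (scale P)
      scale-on ∞        _                 = _
      scale-on (af x y) (x<N , y<N , on) = x<N , red<N (s ℕ.* y) , trans (∼⇒%≡ Y²∼by²) on
        where
        open ∼-Reasoning
        Y = red (s ℕ.* y)
        Y²∼by² : + (1 ℕ.* Y ℕ.* Y) ∼ + (b ℕ.* y ℕ.* y)
        Y²∼by² = begin
          + (1 ℕ.* Y ℕ.* Y)                 ≈⟨ ι** 1 Y Y ⟩
          1ℤ * + Y * + Y                    ≈⟨ *-cong-∼ (*-congˡ-∼ 1ℤ (red-s* y)) (red-s* y) ⟩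
          1ℤ * (+ s * + y) * (+ s * + y)    ≡⟨ rearrange (+ s) (+ y) ⟩
          + s * + s * + y * + y             ≈⟨ *-congʳ-∼ (+ y) (*-congʳ-∼ (+ y) b∼s*s) ⟨
          + b * + y * + y                   ≈⟨ ι** b y y ⟨
          + (b ℕ.* y ℕ.* y)                 ∎
          where
          rearrange : ∀ s y → 1ℤ * (s * y) * (s * y) ≡ s * s * y * y
          rearrange = solve-∀

      unscale-on : ∀ P → OnCurve N E₁ P → OnCurve N Eb (unscale P)
      unscale-on ∞        _                 = _
      unscale-on (af x y) (x<N , y<N , on) = x<N , red<N (s⁻¹ ℕ.* y) , trans (∼⇒%≡ bT²∼y²) on
        where
        open ∼-Reasoning
        T = red (s⁻¹ ℕ.* y)
        red-s⁻¹* : + T ∼ + s⁻¹ * + y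
        red-s⁻¹* = ∼-trans (red-∼ (s⁻¹ ℕ.* y)) (ι* s⁻¹ y)
        bT²∼y² : + (b ℕ.* T ℕ.* T) ∼ + (1 ℕ.* y ℕ.* y)
        bT²∼y² = begin
          + (b ℕ.* T ℕ.* T)                             ≈⟨ ι** b T T ⟩
          + b * + T * + T                               ≈⟨ *-cong-∼ (*-cong-∼ b∼s*s red-s⁻¹*) red-s⁻¹* ⟩
          + s * + s * (+ s⁻¹ * + y) * (+ s⁻¹ * + y)     ≡⟨ rearrange (+ s) (+ s⁻¹) (+ y) ⟩
          (+ s⁻¹ * + s) * (+ s⁻¹ * + s) * + y * + y     ≈⟨ *-congʳ-∼ (+ y) (*-congʳ-∼ (+ y) (*-cong-∼ s⁻¹*s∼1 s⁻¹*s∼1)) ⟩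
          1ℤ * 1ℤ * + y * + y                           ≈⟨ ι** 1 y y ⟨
          + (1 ℕ.* y ℕ.* y)                             ∎
          where
          rearrange : ∀ s t y → s * s * (t * y) * (t * y) ≡ (t * s) * (t * s) * y * y
          rearrange = solve-∀

      private
        cancel : ∀ u v y → + u * + v ∼ 1ℤ → + (u ℕ.* red (v ℕ.* y)) ∼ + y
        cancel u v y uv∼1 = begin
          + (u ℕ.* red (v ℕ.* y))    ≈⟨ ι* u (red (v ℕ.* y)) ⟩
          + u * + red (v ℕ.* y)      ≈⟨ *-congˡ-∼ (+ u) (∼-trans (red-∼ (v ℕ.* y)) (ι* v y)) ⟩
          + u * (+ v * + y)          ≡⟨ ℤ.*-assoc (+ u) (+ v) (+ y) ⟨
          + u * + v * + y            ≈⟨ *-congʳ-∼ (+ y) uv∼1 ⟩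
          1ℤ * + y                   ≡⟨ ℤ.*-identityˡ (+ y) ⟩
          + y                        ∎
          where open ∼-Reasoning

      unscale-scale : ∀ P → OnCurve N Eb P → unscale (scale P) ≡ P
      unscale-scale ∞        _             = refl
      unscale-scale (af x y) (_ , y<N , _) = cong (af x) (trans (∼⇒%≡ (cancel s⁻¹ s y s⁻¹*s∼1)) (red-reduced y<N))

      scale-unscale : ∀ P → OnCurve N E₁ P → scale (unscale P) ≡ P
      scale-unscale ∞        _             = refl
      scale-unscale (af x y) (_ , y<N , _) =
        cong (af x) (trans (∼⇒%≡ (cancel s s⁻¹ y (subst (_∼ 1ℤ) (ℤ.*-comm (+ s⁻¹) (+ s)) s⁻¹*s∼1))) (red-reduced y<N))

      -- The where-bound helpers of add, restated so that add P Q unfolds to them.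
      private
        x₃ : ℕ → ℕ → ℕ → ℕ → ℕ
        x₃ b′ x₁ x₂ λ′ = red (b′ ℕ.* λ′ ℕ.* λ′ ℕ.+ neg x₁ ℕ.+ neg x₂)

        third : ℕ → ℕ → ℕ → ℕ → ℕ → Pt
        third b′ x₁ y₁ x₂ λ′ = af (x₃ b′ x₁ x₂ λ′) (red (λ′ ℕ.* (x₁ ℕ.+ neg (x₃ b′ x₁ x₂ λ′)) ℕ.+ neg y₁))

        scale-if : ∀ (t : Bool) {P Q P′ Q′} → scale P ≡ P′ → scale Q ≡ Q′ →
                   scale (if t then P else Q) ≡ (if t then P′ else Q′)
        scale-if true  sP≡P′ _     = sP≡P′
        scale-if false _     sQ≡Q′ = sQ≡Q′

        x₃-scaled : ∀ x₁ x₂ {λ′ Λ} → + Λ ∼ + s * + λ′ → x₃ 1 x₁ x₂ Λ ≡ x₃ b x₁ x₂ λ′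
        x₃-scaled x₁ x₂ {λ′} {Λ} Λ∼sλ = ∼⇒%≡ (ι+-congʳ (neg x₂) (ι+-congʳ (neg x₁) Λ²∼bλ²))
          where
          open ∼-Reasoning
          Λ²∼bλ² : + (1 ℕ.* Λ ℕ.* Λ) ∼ + (b ℕ.* λ′ ℕ.* λ′)
          Λ²∼bλ² = begin
            + (1 ℕ.* Λ ℕ.* Λ)               ≈⟨ ι** 1 Λ Λ ⟩
            1ℤ * + Λ * + Λ                  ≈⟨ *-cong-∼ (*-congˡ-∼ 1ℤ Λ∼sλ) Λ∼sλ ⟩
            1ℤ * (+ s * + λ′) * (+ s * + λ′) ≡⟨ rearrange (+ s) (+ λ′) ⟩
            + s * + s * + λ′ * + λ′         ≈⟨ *-congʳ-∼ (+ λ′) (*-congʳ-∼ (+ λ′) b∼s*s) ⟨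
            + b * + λ′ * + λ′               ≈⟨ ι** b λ′ λ′ ⟨
            + (b ℕ.* λ′ ℕ.* λ′)             ∎
            where
            rearrange : ∀ s y → 1ℤ * (s * y) * (s * y) ≡ s * s * y * y
            rearrange = solve-∀

        third-scaled : ∀ x₁ y₁ x₂ {λ′ Λ} → y₁ ≤ N → + Λ ∼ + s * + λ′ →
                       scale (third b x₁ y₁ x₂ λ′) ≡ third 1 x₁ (red (s ℕ.* y₁)) x₂ Λ
        third-scaled x₁ y₁ x₂ {λ′} {Λ} y₁≤N Λ∼sλ =
          cong₂ af (sym X₃≡) (trans (∼⇒%≡ (∼-sym y₃-scaled)) (cong (λ z → red (Λ ℕ.* (x₁ ℕ.+ neg z) ℕ.+ neg Y₁)) (sym X₃≡)))
          where
          X₃≡ = x₃-scaled x₁ x₂ Λ∼sλ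
          open ∼-Reasoning
          X₃ = x₃ b x₁ x₂ λ′
          W = x₁ ℕ.+ neg X₃
          Y₁ = red (s ℕ.* y₁)
          y₃-scaled : + (Λ ℕ.* W ℕ.+ neg Y₁) ∼ + (s ℕ.* red (λ′ ℕ.* W ℕ.+ neg y₁))
          y₃-scaled = begin
            + (Λ ℕ.* W ℕ.+ neg Y₁)                 ≈⟨ ∼-trans (ι+ (Λ ℕ.* W) (neg Y₁)) (+-cong-∼ (ι* Λ W) (neg-∼ (ℕ.<⇒≤ (red<N (s ℕ.* y₁))))) ⟩
            + Λ * + W - + Y₁                       ≈⟨ +-cong-∼ (*-congʳ-∼ (+ W) Λ∼sλ) (-‿cong-∼ (red-s* y₁)) ⟩
            + s * + λ′ * + W - + s * + y₁          ≡⟨ factor (+ s) (+ λ′) (+ W) (+ y₁) ⟩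
            + s * (+ λ′ * + W - + y₁)              ≈⟨ *-congˡ-∼ (+ s) (∼-trans (ι+ (λ′ ℕ.* W) (neg y₁)) (+-cong-∼ (ι* λ′ W) (neg-∼ y₁≤N))) ⟨
            + s * + (λ′ ℕ.* W ℕ.+ neg y₁)          ≈⟨ *-congˡ-∼ (+ s) (red-∼ (λ′ ℕ.* W ℕ.+ neg y₁)) ⟨
            + s * + red (λ′ ℕ.* W ℕ.+ neg y₁)      ≈⟨ ι* s (red (λ′ ℕ.* W ℕ.+ neg y₁)) ⟨
            + (s ℕ.* red (λ′ ℕ.* W ℕ.+ neg y₁))    ∎
            where
            factor : ∀ s l w y → s * l * w - s * y ≡ s * (l * w - y)
            factor = solve-∀

        ≡ᵇ0-cong : ∀ {u v} → (u ≡ 0 → v ≡ 0) → (v ≡ 0 → u ≡ 0) → (u ≡ᵇ 0) ≡ (v ≡ᵇ 0)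
        ≡ᵇ0-cong {zero}  {zero}  _   _   = refl
        ≡ᵇ0-cong {zero}  {suc v} u⇒v _   with () ← u⇒v refl
        ≡ᵇ0-cong {suc u} {zero}  _   v⇒u with () ← v⇒u refl
        ≡ᵇ0-cong {suc u} {suc v} _   _   = refl

        red≡0⇒∼0 : ∀ u → red u ≡ 0 → + u ∼ 0ℤ
        red≡0⇒∼0 u red≡0 = ∼-trans (∼-sym (red-∼ u)) (≈⇒∼ (cong +_ red≡0))

        opposite-scaled : ∀ y₁ y₂ → (red (y₁ ℕ.+ y₂) ≡ᵇ 0) ≡ (red (red (s ℕ.* y₁) ℕ.+ red (s ℕ.* y₂)) ≡ᵇ 0)
        opposite-scaled y₁ y₂ = ≡ᵇ0-cong (λ e → ∼⇒%≡ (∼-trans Y₁+Y₂∼s[y₁+y₂] (∼-trans (*-congˡ-∼ (+ s) (red≡0⇒∼0 _ e)) (≈⇒∼ (ℤ.*-zeroʳ (+ s))))))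
                                          (λ e → ∼⇒%≡ (s*y∼0 (∼-trans (∼-sym Y₁+Y₂∼s[y₁+y₂]) (red≡0⇒∼0 _ e))))
          where
          Y₁+Y₂∼s[y₁+y₂] : + (red (s ℕ.* y₁) ℕ.+ red (s ℕ.* y₂)) ∼ + s * + (y₁ ℕ.+ y₂)
          Y₁+Y₂∼s[y₁+y₂] = ∼-trans (ι+ (red (s ℕ.* y₁)) (red (s ℕ.* y₂))) (∼-trans (+-cong-∼ (red-s* y₁) (red-s* y₂))
                             (≈⇒∼ (trans (sym (ℤ.*-distribˡ-+ (+ s) (+ y₁) (+ y₂))) (cong (+ s *_) (sym (ℤ.pos-+ y₁ y₂))))))
          s*y∼0 : ∀ {y} → + s * y ∼ 0ℤ → y ∼ 0ℤ
          s*y∼0 sy∼0 with *∼0⇒∼0⊎∼0 sy∼0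
          ... | inj₁ s∼0 = ⊥-elim (s≁0 s∼0)
          ... | inj₂ y∼0 = y∼0

        chord-scaled : ∀ x₁ y₁ x₂ y₂ → y₁ ≤ N →
          + red ((red (s ℕ.* y₂) ℕ.+ neg (red (s ℕ.* y₁))) ℕ.* inv (red (x₂ ℕ.+ neg x₁)))
            ∼ + s * + red ((y₂ ℕ.+ neg y₁) ℕ.* inv (red (x₂ ℕ.+ neg x₁)))
        chord-scaled x₁ y₁ x₂ y₂ y₁≤N = begin
          + red ((Y₂ ℕ.+ neg Y₁) ℕ.* I)      ≈⟨ ∼-trans (red-∼ _) (ι* (Y₂ ℕ.+ neg Y₁) I) ⟩
          + (Y₂ ℕ.+ neg Y₁) * + I            ≈⟨ *-congʳ-∼ (+ I) (∼-trans (ι+ Y₂ (neg Y₁)) (+-cong-∼ (red-s* y₂) (∼-trans (neg-∼ (ℕ.<⇒≤ (red<N (s ℕ.* y₁)))) (-‿cong-∼ (red-s* y₁))))) ⟩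
          (+ s * + y₂ - + s * + y₁) * + I    ≡⟨ factor (+ s) (+ y₂) (+ y₁) (+ I) ⟩
          + s * ((+ y₂ - + y₁) * + I)        ≈⟨ *-congˡ-∼ (+ s) (*-congʳ-∼ (+ I) (∼-trans (ι+ y₂ (neg y₁)) (+-congˡ-∼ (+ y₂) (neg-∼ y₁≤N)))) ⟨
          + s * (+ (y₂ ℕ.+ neg y₁) * + I)    ≈⟨ *-congˡ-∼ (+ s) (∼-trans (red-∼ _) (ι* (y₂ ℕ.+ neg y₁) I)) ⟨
          + s * + red ((y₂ ℕ.+ neg y₁) ℕ.* I) ∎
          where
          open ∼-Reasoning
          I = inv (red (x₂ ℕ.+ neg x₁))
          Y₁ = red (s ℕ.* y₁)
          Y₂ = red (s ℕ.* y₂)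
          factor : ∀ s a b i → (s * a - s * b) * i ≡ s * ((a - b) * i)
          factor = solve-∀

        tangent-scaled : ∀ x₁ y₁ →
          + red ((3 ℕ.* x₁ ℕ.* x₁ ℕ.+ a) ℕ.* inv (red (2 ℕ.* 1 ℕ.* red (s ℕ.* y₁))))
            ∼ + s * + red ((3 ℕ.* x₁ ℕ.* x₁ ℕ.+ a) ℕ.* inv (red (2 ℕ.* b ℕ.* y₁)))
        tangent-scaled x₁ y₁ = begin
          + red (A ℕ.* inv D₁)                  ≈⟨ ∼-trans (red-∼ (A ℕ.* inv D₁)) (ι* A (inv D₁)) ⟩
          + A * + inv D₁                        ≈⟨ *-congˡ-∼ (+ A) (∼-trans (inv-∼ D₁) (^-cong-∼ k D₁∼B)) ⟩
          + A * B ^ k                           ≡⟨ ℤ.*-identityˡ (+ A * B ^ k) ⟨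
          1ℤ * (+ A * B ^ k)                    ≈⟨ *-congʳ-∼ (+ A * B ^ k) (fermat-^m s≁0) ⟨
          + s * (+ s) ^ k * (+ A * B ^ k)       ≡⟨ rearrange (+ s) ((+ s) ^ k) (+ A) (B ^ k) ⟩
          + s * (+ A * ((+ s) ^ k * B ^ k))     ≡⟨ cong (λ e → + s * (+ A * e)) (^-distribʳ-* (+ s) B k) ⟨
          + s * (+ A * (+ s * B) ^ k)           ≈⟨ *-congˡ-∼ (+ s) (*-congˡ-∼ (+ A) (∼-trans (inv-∼ D₂) (^-cong-∼ k D₂∼sB))) ⟨
          + s * (+ A * + inv D₂)                ≈⟨ *-congˡ-∼ (+ s) (∼-trans (red-∼ (A ℕ.* inv D₂)) (ι* A (inv D₂))) ⟨
          + s * + red (A ℕ.* inv D₂)            ∎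
          where
          open ∼-Reasoning
          A = 3 ℕ.* x₁ ℕ.* x₁ ℕ.+ a
          D₁ = red (2 ℕ.* 1 ℕ.* red (s ℕ.* y₁))
          D₂ = red (2 ℕ.* b ℕ.* y₁)
          B = + 2 * + s * + y₁
          rearrange : ∀ s t a u → s * t * (a * u) ≡ s * (a * (t * u))
          rearrange = solve-∀
          D₁∼B : + D₁ ∼ B
          D₁∼B = begin
            + D₁                          ≈⟨ ∼-trans (red-∼ _) (ι** 2 1 (red (s ℕ.* y₁))) ⟩
            + 2 * 1ℤ * + red (s ℕ.* y₁)   ≈⟨ *-congˡ-∼ (+ 2 * 1ℤ) (red-s* y₁) ⟩
            + 2 * 1ℤ * (+ s * + y₁)       ≡⟨ drop-1 (+ s) (+ y₁) ⟩
            B                             ∎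
            where
            drop-1 : ∀ s y → + 2 * 1ℤ * (s * y) ≡ + 2 * s * y
            drop-1 = solve-∀
          D₂∼sB : + D₂ ∼ + s * B
          D₂∼sB = begin
            + D₂                          ≈⟨ ∼-trans (red-∼ _) (ι** 2 b y₁) ⟩
            + 2 * + b * + y₁              ≈⟨ *-congʳ-∼ (+ y₁) (*-congˡ-∼ (+ 2) b∼s*s) ⟩
            + 2 * (+ s * + s) * + y₁      ≡⟨ pull-s (+ s) (+ y₁) ⟩
            + s * B                       ∎
            where
            pull-s : ∀ s y → + 2 * (s * s) * y ≡ s * (+ 2 * s * y)
            pull-s = solve-∀

      scale-homomorphic : ∀ P Q → OnCurve N Eb P → OnCurve N Eb Q → scale (add N Eb P Q) ≡ add N E₁ (scale P) (scale Q)
      scale-homomorphic ∞          _          _ _ = refl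
      scale-homomorphic (af _ _)   ∞          _ _ = refl
      scale-homomorphic (af x₁ y₁) (af x₂ y₂) (_ , y₁<N , _) _ = scale-if (x₁ ≡ᵇ x₂) tangent-case chord-case
        where
        y₁≤N = ℕ.<⇒≤ y₁<N
        tangent-case = trans (scale-if (red (y₁ ℕ.+ y₂) ≡ᵇ 0) refl (third-scaled x₁ y₁ x₂ y₁≤N (tangent-scaled x₁ y₁)))
                             (cong (λ t → if t then ∞ else third 1 x₁ (red (s ℕ.* y₁)) x₂ Λ) (opposite-scaled y₁ y₂))
          where Λ = red ((3 ℕ.* x₁ ℕ.* x₁ ℕ.+ a) ℕ.* inv (red (2 ℕ.* 1 ℕ.* red (s ℕ.* y₁))))
        chord-case = third-scaled x₁ y₁ x₂ y₁≤N (chord-scaled x₁ y₁ x₂ y₂ y₁≤N)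

      twist-isomorphism : GroupIso N Eb E₁
      twist-isomorphism = record
        { to = scale ; from = unscale ; to-on = scale-on ; from-on = unscale-on
        ; from-to = unscale-scale ; to-from = scale-unscale ; hom = scale-homomorphic }

module SquareRootOfThirty where

  open import Data.Integer as ℤ using (ℤ; +_; -_; 0ℤ; 1ℤ; -1ℤ)
  import Data.Integer.Properties as ℤ
  open import Data.Nat as ℕ using (ℕ; zero; suc; _<_; _≤_; _%_; _/_; _^_; s≤s; z≤n)
  open import Data.Nat.Primality using (Prime)
  import Data.Nat.Properties as ℕ
  open import Data.Nat.Tactic.RingSolver using (solve-∀)
  open import Data.Product using (∃-syntax; _×_; _,_; proj₁; proj₂)
  open import Data.Sum using (_⊎_)
  open import Relation.Binary.PropositionalEquality
  open import Relation.Nullary using (¬_)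
  open import Defs
  open Frobenius using (prime>1)
  open IntegersModulo using (^-distribʳ-*; [-a]^[2k]≡a^[2k])
  open Euler using (module Division; module EulerCriterion)
  open GaussSums using (module GaussSum₃; module GaussSum₅)
  open QuadraticCharacterOfTwo using (2^[k*4]∼1)
  open Arithmetic
  open QuadraticTwist using (module Twist)

  record ThirtyConditions (m : ℕ) : Set where
    field
      i j t₃ t₅  : ℕ
      m≡i*i      : m ≡ i ℕ.* i
      m≡j*4*2    : m ≡ j ℕ.* 4 ℕ.* 2
      1+m≡t₃*3+2 : suc m ≡ t₃ ℕ.* 3 ℕ.+ 2
      1+m≡t₅*5+2 : suc m ≡ t₅ ℕ.* 5 ℕ.+ 2
      30<1+m     : 30 < suc m

  S-thirty-conditions : ∀ {p} → Prime p → p % 10 ≡ 1 ⊎ p % 10 ≡ 9 → ∀ n → ThirtyConditions (p ^ 2 ℕ.* 16 ^ suc n)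
  S-thirty-conditions {p} p-prime p≡±1 n = record
    { i = p ℕ.* 4 ^ suc n
    ; j = p ^ 2 ℕ.* 16 ^ n ℕ.* 2
    ; t₃ = suc m / 3
    ; t₅ = suc m / 5
    ; m≡i*i = trans (cong (p ^ 2 ℕ.*_) (16^n≡4^n*4^n (suc n))) (square-of-product p (4 ^ suc n))
    ; m≡j*4*2 = regroup (p ^ 2) (16 ^ n)
    ; 1+m≡t₃*3+2 = 1+ab≡2-mod (p ^ 2) (16 ^ suc n) 3 (p²≡1-mod3 p-prime p≡±1) (a^n≡1-mod 16 (suc n) 3 refl)
    ; 1+m≡t₅*5+2 = 1+ab≡2-mod (p ^ 2) (16 ^ suc n) 5 (p²≡1-mod5 p-prime p≡±1) (a^n≡1-mod 16 (suc n) 5 refl)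
    ; 30<1+m = s≤s (ℕ.≤-trans (ℕ.m≤m+n 30 34) (ℕ.*-mono-≤ (ℕ.^-monoˡ-≤ 2 (prime>1 p-prime)) (ℕ.^-monoʳ-≤ 16 {1} {suc n} (s≤s z≤n)))) }
    where
    m = p ^ 2 ℕ.* 16 ^ suc n
    square-of-product : ∀ p x → p ℕ.* (p ℕ.* 1) ℕ.* (x ℕ.* x) ≡ p ℕ.* x ℕ.* (p ℕ.* x)
    square-of-product = solve-∀
    regroup : ∀ a x → a ℕ.* (16 ℕ.* x) ≡ a ℕ.* x ℕ.* 2 ℕ.* 4 ℕ.* 2
    regroup = solve-∀

  module _ {m : ℕ} (prime : Prime (suc m)) (conditions : ThirtyConditions m) where
    open ThirtyConditions conditions
    open Division m prime

    private
      h : ℕ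
      h = j ℕ.* 4

      2<N : 2 < N
      2<N = ℕ.<-trans (s≤s (s≤s (s≤s z≤n))) 30<1+m

      30≁0 : ¬ + 30 ∼ 0ℤ
      30≁0 = ≢0⇒≁0 (s≤s z≤n) 30<1+m

      j*4≡2*[j*2] : j ℕ.* 4 ≡ 2 ℕ.* (j ℕ.* 2)
      j*4≡2*[j*2] = regroup j
        where
        regroup : ∀ j → j ℕ.* 4 ≡ 2 ℕ.* (j ℕ.* 2)
        regroup = solve-∀

      30^h∼1 : (+ 30) ℤ.^ h ∼ 1ℤ
      30^h∼1 = begin
        (+ 2 ℤ.* + 3 ℤ.* + 5) ℤ.^ h                       ≡⟨ trans (^-distribʳ-* (+ 2 ℤ.* + 3) (+ 5) h) (cong (ℤ._* (+ 5) ℤ.^ h) (^-distribʳ-* (+ 2) (+ 3) h)) ⟩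
        (+ 2) ℤ.^ h ℤ.* (+ 3) ℤ.^ h ℤ.* (+ 5) ℤ.^ h        ≡⟨ cong (λ e → (+ 2) ℤ.^ h ℤ.* e ℤ.* (+ 5) ℤ.^ h) 3^h≡[-3]^h ⟩
        (+ 2) ℤ.^ h ℤ.* (- + 3) ℤ.^ h ℤ.* (+ 5) ℤ.^ h      ≈⟨ *-cong-∼ (*-cong-∼ 2^h∼1 [-3]^h∼-1) 5^h∼-1 ⟩
        1ℤ ℤ.* -1ℤ ℤ.* -1ℤ                                  ∎
        where
        open ∼-Reasoning
        3^h≡[-3]^h : (+ 3) ℤ.^ h ≡ (- + 3) ℤ.^ h
        3^h≡[-3]^h = trans (cong ((+ 3) ℤ.^_) j*4≡2*[j*2]) (trans (sym ([-a]^[2k]≡a^[2k] (+ 3) (j ℕ.* 2))) (cong ((- + 3) ℤ.^_) (sym j*4≡2*[j*2])))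
        2^h∼1 = 2^[k*4]∼1 m prime i j m≡i*i m≡j*4*2 2<N
        [-3]^h∼-1 = GaussSum₃.[-3]^h∼-1 m prime h m≡j*4*2 t₃ 1+m≡t₃*3+2
        5^h∼-1 = GaussSum₅.5^h∼-1 m prime h m≡j*4*2 t₅ 1+m≡t₅*5+2

    thirty-is-a-square : ∃[ s ] ¬ + s ∼ 0ℤ × + (s ℕ.* s) ∼ + 30
    thirty-is-a-square = s , s≁0 , s²∼30
      where
      square-root = EulerCriterion.euler-residue m prime {h = h} 2<N 30≁0 m≡j*4*2 30^h∼1
      s = proj₁ square-root
      s²∼30 : + (s ℕ.* s) ∼ + 30
      s²∼30 = proj₂ (proj₂ square-root)
      s≁0 : ¬ + s ∼ 0ℤ
      s≁0 s∼0 = 30≁0 (∼-trans (∼-sym s²∼30) (subst (_∼ 0ℤ) (sym (ℤ.pos-* s s)) (*-cong-∼ s∼0 s∼0)))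

  twist-by-√30 : ∀ {m} → Prime (suc m) → ThirtyConditions m → GroupIso (suc m) (E₃₀ (suc m)) (E (suc m))
  twist-by-√30 {zero}  _     conditions with s≤s () ← ThirtyConditions.30<1+m conditions
  twist-by-√30 {suc k} q-prime conditions = Twist.twist-isomorphism k q-prime s≁0 (∼-trans s²∼30 (∼-sym (%-∼ 30)))
    where
    open Division (suc k) q-prime
    square-root = thirty-is-a-square q-prime conditions
    s = proj₁ square-root
    s≁0 = proj₁ (proj₂ square-root)
    s²∼30 = proj₂ (proj₂ square-root)

  S≡1+p²16ⁿ : ∀ p n → S p n ≡ suc (p ^ 2 ℕ.* 16 ^ n)
  S≡1+p²16ⁿ p n = ℕ.+-comm (p ^ 2 ℕ.* 16 ^ n) 1

open import Relation.Binary.PropositionalEquality using (subst; sym)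
open SquareRootOfThirty using (S≡1+p²16ⁿ; S-thirty-conditions; twist-by-√30)

lemma4 : (p n : ℕ) → Prime p → (p % 10 ≡ 1 ⊎ p % 10 ≡ 9) → 1 ≤ n →
         Prime (S p n) → GroupIso (S p n) (E₃₀ (S p n)) (E (S p n))
lemma4 p (suc n) p-prime p≡±1 _ S-prime =
  subst (λ q → GroupIso q (E₃₀ q) (E q)) (sym (S≡1+p²16ⁿ p (suc n)))
        (twist-by-√30 (subst Prime (S≡1+p²16ⁿ p (suc n)) S-prime) (S-thirty-conditions p-prime p≡±1 n))
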